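{- Let $q$ be a prime power, $n\ge1$, $m\ge1$, $S=\mathbb F_q[x_1,\dots,x_n]$ with $\mathrm{GL}_n(\mathbb F_q)$ acting by linear substitution, and $\mathfrak m^{[q^m]}=(x_1^{q^m},\dots,x_n^{q^m})$. Suppose $f\in S$ with $f+\mathfrak m^{[q^m]}\in(S/\mathfrak m^{[q^m]})^{\mathrm{GL}_n(\mathbb F_q)}$. Then for every monomial $M\notin\mathfrak m^{[q^m]}$ occurring in $f$, either $M=x_1^{q^m-1}x_2^{q^m-1}\cdots x_n^{q^m-1}$, or $\deg_{x_i}(M)\le q^m-q$ for all $i$. -}

module Defs where

open import Level using (Level; _⊔_)
open import Algebra.Bundles using (CommutativeRing)
open import Data.Nat as ℕ using (ℕ; zero; suc; _^_; _≤_; _<_; _∸_)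
open import Data.Nat.Primality using (Prime)
open import Data.Fin using (Fin)
open import Data.Vec as Vec using (Vec; []; _∷_; replicate; zipWith; tabulate; lookup)
open import Data.List as List using (List; []; _∷_; concat; concatMap; foldr; map; allFin)
open import Data.Product using (Σ; ∃; ∃-syntax; _×_; _,_)
open import Relation.Nullary using (¬_; yes; no)
open import Relation.Binary.PropositionalEquality using (_≡_)
import Data.Vec.Properties as VecP

IsPrimePower : ℕ → Set
IsPrimePower q = ∃[ p ] ∃[ k ] (Prime p × 1 ≤ k × q ≡ p ^ k)

IsField : ∀ {c ℓ} → CommutativeRing c ℓ → Set (c ⊔ ℓ)
IsField R = ¬ (0# ≈ 1#) × (∀ x → ¬ (x ≈ 0#) → ∃[ y ] (x * y ≈ 1#))
  where open CommutativeRing R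

HasCardinality : ∀ {c ℓ} → CommutativeRing c ℓ → ℕ → Set (c ⊔ ℓ)
HasCardinality R q =
  Σ (Fin q → Carrier) λ enum →
    (∀ i j → enum i ≈ enum j → i ≡ j) × (∀ x → ∃[ i ] (enum i ≈ x))
  where open CommutativeRing R

module Poly {c ℓ} (R : CommutativeRing c ℓ) where
  open CommutativeRing R

  -- an exponent vector (e₁,…,eₙ) represents the monomial x₁^e₁ ⋯ xₙ^eₙ
  Exponent : ℕ → Set
  Exponent n = Vec ℕ n

  -- a polynomial is a finite formal sum of terms c·x^e
  -- (equality of polynomials is equality of all coefficients, see coeff)
  Polynomial : ℕ → Set c
  Polynomial n = List (Carrier × Exponent n)

  coeff : ∀ {n} → Polynomial n → Exponent n → Carrier
  coeff []              e = 0#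
  coeff ((a , d) ∷ f)   e with VecP.≡-dec ℕ._≟_ d e
  ... | yes _ = a + coeff f e
  ... | no  _ = coeff f e

  1P : ∀ {n} → Polynomial n
  1P = (1# , replicate _ 0) ∷ []

  _*P_ : ∀ {n} → Polynomial n → Polynomial n → Polynomial n
  f *P g = concatMap (λ { (a , d) → map (λ { (b , e) → (a * b , zipWith ℕ._+_ d e) }) g }) f

  _^P_ : ∀ {n} → Polynomial n → ℕ → Polynomial n
  f ^P zero  = 1P
  f ^P suc k = f *P (f ^P k)

  scaleP : ∀ {n} → Carrier → Polynomial n → Polynomial n
  scaleP a = map (λ { (b , e) → (a * b , e) })

  unitExp : ∀ {n} → Fin n → Exponent n
  unitExp j = tabulate λ k → Data.Fin._≟_ j k |> λ { (yes _) → 1 ; (no _) → 0 }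
    where
      open import Function using (_|>_)
      import Data.Fin

  Matrix : ℕ → Set c
  Matrix n = Fin n → Fin n → Carrier

  sumFin : ∀ {n} → (Fin n → Carrier) → Carrier
  sumFin {n} f = foldr (λ i s → f i + s) 0# (allFin n)

  _*M_ : ∀ {n} → Matrix n → Matrix n → Matrix n
  (A *M B) i k = sumFin λ j → A i j * B j k

  idM : ∀ {n} → Matrix n
  idM i j with Data.Fin._≟_ i j
    where import Data.Fin
  ... | yes _ = 1#
  ... | no  _ = 0#

  _≈M_ : ∀ {n} → Matrix n → Matrix n → Set ℓ
  A ≈M B = ∀ i j → A i j ≈ B i j

  IsInvertible : ∀ {n} → Matrix n → Set (c ⊔ ℓ)
  IsInvertible A = ∃[ B ] ((A *M B) ≈M idM × (B *M A) ≈M idM)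

  linForm : ∀ {n} → Matrix n → Fin n → Polynomial n
  linForm {n} g i = map (λ j → (g i j , unitExp j)) (allFin n)

  -- substitution x_i ↦ Σ_j g_ij x_j :  (g·f)(x) = f(g x)
  act : ∀ {n} → Matrix n → Polynomial n → Polynomial n
  act {n} g = concatMap λ { (a , e) →
    scaleP a (foldr (λ i p → (linForm g i ^P lookup e i) *P p) 1P (allFin n)) }

  -- x^e ∉ 𝔪^[N] = (x₁^N, …, xₙ^N)  iff  every eᵢ < N
  NotInFrobPower : ∀ {n} → ℕ → Exponent n → Set
  NotInFrobPower {n} N e = ∀ i → lookup e i < N

  -- f ≡ g modulo 𝔪^[N]: coefficients agree on all monomials outside 𝔪^[N]
  _≡_mod[_] : ∀ {n} → Polynomial n → Polynomial n → ℕ → Set ℓ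
  f ≡ g mod[ N ] = ∀ e → NotInFrobPower N e → coeff f e ≈ coeff g e

  IsInvariantMod : ∀ {n} → ℕ → Polynomial n → Set (c ⊔ ℓ)
  IsInvariantMod N f = ∀ g → IsInvertible g → act g f ≡ f mod[ N ]

  OccursIn : ∀ {n} → Exponent n → Polynomial n → Set ℓ
  OccursIn e f = ¬ (coeff f e ≈ 0#)

-- Write Q = q^m. Scaling x_i by a unit a multiplies the coefficient of x^e by a^(e_i), so
-- invariance forces a^(e_i) = 1 for every a ∈ F_q^×. As a^(Q-1) = 1 too, and X^r - 1 with
-- 0 < r ≤ q - 2 cannot vanish at all q - 1 units, every exponent e_i > Q - q equals Q - 1.
-- Now let e_i = Q - 1 and e_j < Q - 1, and apply x_i ↦ x_i + x_j. The coefficient of the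
-- image at x^t, t = e - ε_i + ε_j, is coeff_t(f) + (Q - 1) coeff_e(f): any other monomial
-- of f contributes only a binomial (Q - 2 + b choose b) with 2 ≤ b < Q, which vanishes
-- mod p because Q is a power of p. As Q - 1 = -1 ≠ 0 in F_q, invariance at x^t forces
-- coeff_e(f) = 0.

module Submission where

open import Defs
open import Algebra.Bundles using (CommutativeRing)
open import Data.Nat using (ℕ; _^_; _≤_; _∸_)
open import Data.Vec using (replicate; lookup)
open import Data.Sum using (_⊎_)
open import Relation.Binary.PropositionalEquality using (_≡_)

open import Algebra.Bundles using (CommutativeMonoid)
import Relation.Binary.PropositionalEquality as ≡
open ≡ using (_≢_)
open import Data.Nat as ℕ using (zero; suc; _<_; z≤n; s≤s)
import Data.Nat.Properties as ℕ
open import Data.Nat.Combinatorics using (_C_; k>n⇒nCk≡0; nCn≡1; nC1≡n; nCk+nC[k+1]≡[n+1]C[k+1])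
open import Data.Nat.Divisibility using (_∣_; divides; _∣?_; ∣-trans; *-cancelˡ-∣)
open import Data.Nat.Primality using (Prime; euclidsLemma; prime⇒nonZero; prime⇒nonTrivial)
open import Data.Sum using (inj₁; inj₂)
open import Data.Product using (_,_; proj₁; proj₂)
open import Data.List as List using (List; []; _∷_; _++_)
open import Data.Fin as Fin using (Fin)
import Data.Fin.Properties as Finₚ
import Data.Fin.Permutation as Perm
open import Data.Vec using (Vec; []; _∷_; zipWith; tabulate; _[_]≔_)
import Data.Vec.Properties as Vecₚ
open import Data.Bool using (if_then_else_; true; false)
open import Data.Empty using (⊥; ⊥-elim)
open import Relation.Nullary using (¬_; Dec; yes; no; does)
open import Relation.Nullary.Decidable using (dec-true; dec-false)
open import Function using (_∘_)

module Binomial where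
  open ≡ using (refl; sym; trans; cong; cong₂; subst; module ≡-Reasoning)
  open import Data.Nat using (_+_; _*_)
  open import Data.Nat.Tactic.RingSolver using (solve-∀)

  C-absorption : ∀ n k → suc k * (suc n C suc k) ≡ suc n * (n C k)
  C-absorption zero zero = refl
  C-absorption zero (suc k) rewrite k>n⇒nCk≡0 {1} {suc (suc k)} (s≤s (s≤s z≤n)) | k>n⇒nCk≡0 {0} {suc k} (s≤s z≤n)
    = ℕ.*-zeroʳ (suc (suc k))
  C-absorption (suc n) zero = trans (ℕ.+-identityʳ _) (trans (nC1≡n (suc (suc n))) (sym (ℕ.*-identityʳ _)))
  C-absorption (suc n) (suc k) = begin
    suc (suc k) * (suc (suc n) C suc (suc k))           ≡⟨ cong (suc (suc k) *_) (sym (nCk+nC[k+1]≡[n+1]C[k+1] (suc n) (suc k))) ⟩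
    suc (suc k) * (suc n C suc k + suc n C suc (suc k)) ≡⟨ distribute k (suc n C suc k) (suc n C suc (suc k)) ⟩
    suc k * (suc n C suc k) + suc n C suc k + suc (suc k) * (suc n C suc (suc k))
      ≡⟨ cong₂ (λ x y → x + suc n C suc k + y) (C-absorption n k) (C-absorption n (suc k)) ⟩
    suc n * (n C k) + suc n C suc k + suc n * (n C suc k) ≡⟨ collect (suc n) (n C k) (n C suc k) (suc n C suc k) ⟩
    suc n * (n C k + n C suc k) + suc n C suc k         ≡⟨ cong (λ x → suc n * x + suc n C suc k) (nCk+nC[k+1]≡[n+1]C[k+1] n k) ⟩
    suc n * (suc n C suc k) + suc n C suc k             ≡⟨ ℕ.+-comm (suc n * (suc n C suc k)) _ ⟩
    suc (suc n) * (suc n C suc k)                       ∎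
    where
    open ≡-Reasoning
    distribute : ∀ a x y → suc (suc a) * (x + y) ≡ suc a * x + x + suc (suc a) * y
    distribute = solve-∀
    collect : ∀ a x y z → a * x + z + a * y ≡ a * (x + y) + z
    collect = solve-∀

  pᵃ∣r*x⇒p∣x : ∀ {p} → Prime p → ∀ a r x → 0 < r → r < p ^ a → p ^ a ∣ r * x → p ∣ x
  pᵃ∣r*x⇒p∣x p-prime zero r x 0<r r<1 _ = ⊥-elim (ℕ.<-irrefl refl (ℕ.≤-trans 0<r (ℕ.≤-pred r<1)))
  pᵃ∣r*x⇒p∣x {p} p-prime (suc a) r x 0<r r<pᵃ⁺¹ pᵃ⁺¹∣r*x with p ∣? r
  ... | no p∤r with euclidsLemma r x p-prime (∣-trans (divides (p ^ a) (ℕ.*-comm p (p ^ a))) pᵃ⁺¹∣r*x)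
  ...   | inj₁ p∣r = ⊥-elim (p∤r p∣r)
  ...   | inj₂ p∣x = p∣x
  pᵃ∣r*x⇒p∣x {p} p-prime (suc a) r x 0<r r<pᵃ⁺¹ pᵃ⁺¹∣r*x | yes (divides (suc r′) refl) =
    pᵃ∣r*x⇒p∣x p-prime a (suc r′) x (s≤s z≤n) r′<pᵃ pᵃ∣r′*x
    where
    instance
      _ = prime⇒nonZero p-prime
    r′<pᵃ : suc r′ < p ^ a
    r′<pᵃ = ℕ.*-cancelʳ-< p (suc r′) (p ^ a) (subst (suc r′ * p <_) (ℕ.*-comm p (p ^ a)) r<pᵃ⁺¹)
    pᵃ∣r′*x : p ^ a ∣ suc r′ * x
    pᵃ∣r′*x = *-cancelˡ-∣ p (subst (p ^ suc a ∣_) (trans (cong (_* x) (ℕ.*-comm (suc r′) p)) (ℕ.*-assoc p (suc r′) x)) pᵃ⁺¹∣r*x)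

  prime∣pᵃCr : ∀ {p} → Prime p → ∀ a r → 0 < r → r < p ^ a → p ∣ (p ^ a) C r
  prime∣pᵃCr {p} p-prime a (suc r) 0<r r<pᵃ with p ^ a in pᵃ≡N
  ... | suc N = pᵃ∣r*x⇒p∣x p-prime a (suc r) (suc N C suc r) 0<r (subst (suc r <_) (sym pᵃ≡N) r<pᵃ)
                  (subst (_∣ suc r * (suc N C suc r)) (sym pᵃ≡N)
                    (divides (N C r) (trans (C-absorption N r) (ℕ.*-comm (suc N) (N C r)))))

module ExponentVector where
  open ≡ using (refl; sym; trans; cong; cong₂; module ≡-Reasoning)
  open import Data.Nat using (_+_)
  open import Data.Fin using (_≟_)

  infixl 6 _⊕_
  _⊕_ : ∀ {n} → Vec ℕ n → Vec ℕ n → Vec ℕ n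
  _⊕_ = zipWith _+_

  𝟎 : ∀ {n} → Vec ℕ n
  𝟎 = replicate _ 0

  single : ∀ {n} → Fin n → ℕ → Vec ℕ n
  single k a = 𝟎 [ k ]≔ a

  lookup-⊕ : ∀ {n} (u v : Vec ℕ n) i → lookup (u ⊕ v) i ≡ lookup u i + lookup v i
  lookup-⊕ u v i = Vecₚ.lookup-zipWith _+_ i u v

  ≗-lookup⇒≡ : ∀ {n} (u v : Vec ℕ n) → (∀ i → lookup u i ≡ lookup v i) → u ≡ v
  ≗-lookup⇒≡ u v u≗v = trans (sym (Vecₚ.tabulate∘lookup u)) (trans (Vecₚ.tabulate-cong u≗v) (Vecₚ.tabulate∘lookup v))

  ⊕-assoc : ∀ {n} (u v w : Vec ℕ n) → (u ⊕ v) ⊕ w ≡ u ⊕ (v ⊕ w)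
  ⊕-assoc = Vecₚ.zipWith-assoc ℕ.+-assoc

  ⊕-comm : ∀ {n} (u v : Vec ℕ n) → u ⊕ v ≡ v ⊕ u
  ⊕-comm = Vecₚ.zipWith-comm ℕ.+-comm

  ⊕-identityˡ : ∀ {n} (v : Vec ℕ n) → 𝟎 ⊕ v ≡ v
  ⊕-identityˡ = Vecₚ.zipWith-identityˡ ℕ.+-identityˡ

  ⊕-exchange : ∀ {n} (u v w : Vec ℕ n) → u ⊕ (v ⊕ w) ≡ v ⊕ (u ⊕ w)
  ⊕-exchange u v w = trans (sym (⊕-assoc u v w)) (trans (cong (_⊕ w) (⊕-comm u v)) (⊕-assoc v u w))

  lookup-single-same : ∀ {n} (k : Fin n) a → lookup (single k a) k ≡ a
  lookup-single-same k a = Vecₚ.lookup∘updateAt k 𝟎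

  lookup-single-other : ∀ {n} {k l : Fin n} a → k ≢ l → lookup (single k a) l ≡ 0
  lookup-single-other {k = k} {l} a k≢l = trans (Vecₚ.lookup∘updateAt′ l k (k≢l ∘ sym) 𝟎) (Vecₚ.lookup-replicate l 0)

  single-zero : ∀ {n} (k : Fin n) → single k 0 ≡ 𝟎
  single-zero k = ≗-lookup⇒≡ _ _ λ l → trans (lookup-single k l) (sym (Vecₚ.lookup-replicate l 0))
    where
    lookup-single : ∀ k l → lookup (single k 0) l ≡ 0
    lookup-single k l with k ≟ l
    ... | yes refl = lookup-single-same k 0
    ... | no k≢l = lookup-single-other 0 k≢l

  single-⊕ : ∀ {n} (k : Fin n) a b → single k a ⊕ single k b ≡ single k (a + b)
  single-⊕ k a b = ≗-lookup⇒≡ _ _ λ l → trans (lookup-⊕ (single k a) (single k b) l) (pointwise l)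
    where
    pointwise : ∀ l → lookup (single k a) l + lookup (single k b) l ≡ lookup (single k (a + b)) l
    pointwise l with k ≟ l
    ... | yes refl = trans (cong₂ _+_ (lookup-single-same k a) (lookup-single-same k b)) (sym (lookup-single-same k (a + b)))
    ... | no k≢l = trans (cong₂ _+_ (lookup-single-other a k≢l) (lookup-single-other b k≢l)) (sym (lookup-single-other (a + b) k≢l))

  single-⊕-cleared : ∀ {n} (i : Fin n) d → single i (lookup d i) ⊕ (d [ i ]≔ 0) ≡ d
  single-⊕-cleared i d = ≗-lookup⇒≡ _ _ λ l → trans (lookup-⊕ (single i (lookup d i)) (d [ i ]≔ 0) l) (pointwise l)
    where
    pointwise : ∀ l → lookup (single i (lookup d i)) l + lookup (d [ i ]≔ 0) l ≡ lookup d l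
    pointwise l with i ≟ l
    ... | yes refl = trans (cong₂ _+_ (lookup-single-same i _) (Vecₚ.lookup∘updateAt i d)) (ℕ.+-identityʳ _)
    ... | no i≢l = trans (cong₂ _+_ (lookup-single-other _ i≢l) (Vecₚ.lookup∘updateAt′ l i (i≢l ∘ sym) d)) refl

  assemble : ∀ {n} → List (Fin n) → Vec ℕ n → Vec ℕ n
  assemble ks v = List.foldr (λ k w → single k (lookup v k) ⊕ w) 𝟎 ks

  assemble-allFin : ∀ {n} (v : Vec ℕ n) → assemble (List.allFin n) v ≡ v
  assemble-allFin {zero} [] = refl
  assemble-allFin {suc n} (x ∷ v) = begin
    single Fin.zero x ⊕ assemble (List.tabulate Fin.suc) (x ∷ v) ≡⟨ cong (single Fin.zero x ⊕_) (assemble-suc (λ k → k)) ⟩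
    (x + 0) ∷ 𝟎 ⊕ assemble (List.allFin n) v            ≡⟨ cong₂ _∷_ (ℕ.+-identityʳ x) (trans (⊕-identityˡ _) (assemble-allFin v)) ⟩
    x ∷ v                                          ∎
    where
    open ≡-Reasoning
    assemble-suc : ∀ {m} (f : Fin m → Fin n) → assemble (List.tabulate (Fin.suc ∘ f)) (x ∷ v) ≡ 0 ∷ assemble (List.tabulate f) v
    assemble-suc {zero} f = refl
    assemble-suc {suc m} f = cong (single (Fin.suc (f Fin.zero)) (lookup v (f Fin.zero)) ⊕_) (assemble-suc (f ∘ Fin.suc))

open Binomial
open ExponentVector

module Pairing {c ℓ} (R : CommutativeRing c ℓ) where
  open CommutativeRing R hiding (zero)
  open Poly R
  open import Data.Product using (_×_)
  open import Relation.Binary.Reasoning.Setoid setoid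
  open import Algebra.Solver.Ring.NaturalCoefficients.Default commutativeSemiring using (solve; _:+_; _:*_; _:=_)

  module _ {n : ℕ} where

    -- Polynomials are lists that may repeat monomials, so they are handled through this
    -- linear functional; pairing with the indicator of e gives the coefficient of x^e.
    pairing : Polynomial n → (Exponent n → Carrier) → Carrier
    pairing [] h = 0#
    pairing ((a , d) ∷ P) h = a * h d + pairing P h

    pairing-congʳ : ∀ P {h h′ : Exponent n → Carrier} → (∀ d → h d ≈ h′ d) → pairing P h ≈ pairing P h′
    pairing-congʳ [] h≈h′ = refl
    pairing-congʳ ((a , d) ∷ P) h≈h′ = +-cong (*-congˡ (h≈h′ d)) (pairing-congʳ P h≈h′)

    pairing-++ : ∀ P Q h → pairing (P ++ Q) h ≈ pairing P h + pairing Q h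
    pairing-++ [] Q h = sym (+-identityˡ _)
    pairing-++ ((a , d) ∷ P) Q h = trans (+-congˡ (pairing-++ P Q h)) (sym (+-assoc _ _ _))

    pairing-zero : ∀ P → pairing P (λ _ → 0#) ≈ 0#
    pairing-zero [] = refl
    pairing-zero ((a , d) ∷ P) = trans (+-cong (zeroʳ a) (pairing-zero P)) (+-identityʳ _)

    pairing-+ : ∀ P h h′ → pairing P (λ d → h d + h′ d) ≈ pairing P h + pairing P h′
    pairing-+ [] h h′ = sym (+-identityˡ _)
    pairing-+ ((a , d) ∷ P) h h′ = trans (+-cong (distribˡ a (h d) (h′ d)) (pairing-+ P h h′))
      (solve 4 (λ x y z w → (x :+ y) :+ (z :+ w) := (x :+ z) :+ (y :+ w)) refl (a * h d) (a * h′ d) (pairing P h) (pairing P h′))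

    pairing-*ʳ : ∀ P x h → pairing P (λ d → x * h d) ≈ x * pairing P h
    pairing-*ʳ [] x h = sym (zeroʳ x)
    pairing-*ʳ ((a , d) ∷ P) x h =
      trans (+-cong (solve 3 (λ a x y → a :* (x :* y) := x :* (a :* y)) refl a x (h d)) (pairing-*ʳ P x h))
            (sym (distribˡ x _ _))

    pairing-scaleP : ∀ a P h → pairing (scaleP a P) h ≈ a * pairing P h
    pairing-scaleP a [] h = sym (zeroʳ a)
    pairing-scaleP a ((b , e) ∷ P) h = trans (+-cong (*-assoc a b _) (pairing-scaleP a P h)) (sym (distribˡ a _ _))

    pairing-exchange : ∀ P Q (H : Exponent n → Exponent n → Carrier) →
                       pairing P (λ d → pairing Q (H d)) ≈ pairing Q (λ e → pairing P (λ d → H d e))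
    pairing-exchange [] Q H = sym (pairing-zero Q)
    pairing-exchange ((a , d) ∷ P) Q H = begin
      a * pairing Q (H d) + pairing P (λ d → pairing Q (H d))           ≈⟨ +-cong (sym (pairing-*ʳ Q a (H d))) (pairing-exchange P Q H) ⟩
      pairing Q (λ e → a * H d e) + pairing Q (λ e → pairing P (λ d → H d e)) ≈⟨ pairing-+ Q _ _ ⟨
      pairing Q (λ e → a * H d e + pairing P (λ d → H d e))             ∎

    pairing-concatMap : ∀ (t : Carrier × Exponent n → Polynomial n) P h (H : Exponent n → Carrier) →
                        (∀ a d → pairing (t (a , d)) h ≈ a * H d) → pairing (List.concatMap t P) h ≈ pairing P H
    pairing-concatMap t [] h H t≈ = refl
    pairing-concatMap t ((a , d) ∷ P) h H t≈ =
      trans (pairing-++ (t (a , d)) (List.concatMap t P) h) (+-cong (t≈ a d) (pairing-concatMap t P h H t≈))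

    pairing-1P : ∀ h → pairing 1P h ≈ h 𝟎
    pairing-1P h = trans (+-identityʳ _) (*-identityˡ _)

    adjoint : Polynomial n → (Exponent n → Carrier) → Exponent n → Carrier
    adjoint A h v = pairing A (λ w → h (w ⊕ v))

    pairing-*P : ∀ A B h → pairing (A *P B) h ≈ pairing B (adjoint A h)
    pairing-*P A B h = trans (pairing-concatMap _ A h _ (λ a d → shifted a d B)) (pairing-exchange A B _)
      where
      shifted : ∀ a d B → pairing (List.map (λ { (b , e) → (a * b , d ⊕ e) }) B) h ≈ a * pairing B (λ e → h (d ⊕ e))
      shifted a d [] = sym (zeroʳ a)
      shifted a d ((b , e) ∷ B) = trans (+-cong (*-assoc a b _) (shifted a d B)) (sym (distribˡ a _ _))

    adjoint-congʳ : ∀ A {h h′ : Exponent n → Carrier} v → (∀ d → h d ≈ h′ d) → adjoint A h v ≈ adjoint A h′ v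
    adjoint-congʳ A v h≈h′ = pairing-congʳ A (λ w → h≈h′ (w ⊕ v))

    adjoint-shift : ∀ A (h : Exponent n → Carrier) u v → adjoint A (λ w → h (u ⊕ w)) v ≈ adjoint A h (u ⊕ v)
    adjoint-shift A h u v = pairing-congʳ A (λ w → reflexive (≡.cong h (⊕-exchange u w v)))

    δ : Exponent n → Exponent n → Carrier
    δ e d with Vecₚ.≡-dec ℕ._≟_ d e
    ... | yes _ = 1#
    ... | no _ = 0#

    δ-refl : ∀ e → δ e e ≈ 1#
    δ-refl e with Vecₚ.≡-dec ℕ._≟_ e e
    ... | yes _ = refl
    ... | no e≢e = ⊥-elim (e≢e ≡.refl)

    δ-≢ : ∀ {e d} → d ≢ e → δ e d ≈ 0#
    δ-≢ {e} {d} d≢e with Vecₚ.≡-dec ℕ._≟_ d e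
    ... | yes d≡e = ⊥-elim (d≢e d≡e)
    ... | no _ = refl

    coeff≈pairing-δ : ∀ P e → coeff P e ≈ pairing P (δ e)
    coeff≈pairing-δ [] e = refl
    coeff≈pairing-δ ((a , d) ∷ P) e with Vecₚ.≡-dec ℕ._≟_ d e
    ... | yes _ = +-cong (sym (*-identityʳ a)) (coeff≈pairing-δ P e)
    ... | no _ = trans (coeff≈pairing-δ P e) (trans (sym (+-identityˡ _)) (+-congʳ (sym (zeroʳ a))))

module BinomialSum {c ℓ} (R : CommutativeRing c ℓ) where
  open CommutativeRing R hiding (zero)
  open import Algebra.Properties.Semiring.Mult semiring using (_×_; ×-homo-+)
  open import Relation.Binary.Reasoning.Setoid setoid
  open import Algebra.Solver.Ring.NaturalCoefficients.Default commutativeSemiring using (solve; _:+_; _:=_)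

  -- binomialSum N φ = Σ_{a + b = N} (N choose b) φ a b
  binomialSum : ℕ → (ℕ → ℕ → Carrier) → Carrier
  binomialSum zero φ = φ 0 0
  binomialSum (suc N) φ = binomialSum N (λ a b → φ (suc a) b + φ a (suc b))

  binomialSum-cong : ∀ N {φ ψ : ℕ → ℕ → Carrier} → (∀ a b → a ℕ.+ b ≡ N → φ a b ≈ ψ a b) →
                     binomialSum N φ ≈ binomialSum N ψ
  binomialSum-cong zero φ≈ψ = φ≈ψ 0 0 ≡.refl
  binomialSum-cong (suc N) φ≈ψ = binomialSum-cong N λ a b a+b≡N →
    +-cong (φ≈ψ (suc a) b (≡.cong suc a+b≡N)) (φ≈ψ a (suc b) (≡.trans (ℕ.+-suc a b) (≡.cong suc a+b≡N)))

  binomialSum-zero : ∀ N → binomialSum N (λ _ _ → 0#) ≈ 0#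
  binomialSum-zero zero = refl
  binomialSum-zero (suc N) = trans (binomialSum-cong N (λ _ _ _ → +-identityˡ 0#)) (binomialSum-zero N)

  binomialSum-+ : ∀ N (φ ψ : ℕ → ℕ → Carrier) → binomialSum N (λ a b → φ a b + ψ a b) ≈ binomialSum N φ + binomialSum N ψ
  binomialSum-+ zero φ ψ = refl
  binomialSum-+ (suc N) φ ψ = trans (binomialSum-cong N (λ a b _ → interchange (φ (suc a) b) (ψ (suc a) b) (φ a (suc b)) (ψ a (suc b))))
                                    (binomialSum-+ N _ _)
    where
    interchange : ∀ w x y z → (w + x) + (y + z) ≈ (w + y) + (x + z)
    interchange = solve 4 (λ w x y z → (w :+ x) :+ (y :+ z) := (w :+ y) :+ (x :+ z)) refl

  binomialSum-*ˡ : ∀ N x (φ : ℕ → ℕ → Carrier) → binomialSum N (λ a b → x * φ a b) ≈ x * binomialSum N φ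
  binomialSum-*ˡ zero x φ = refl
  binomialSum-*ˡ (suc N) x φ = trans (binomialSum-cong N (λ a b _ → sym (distribˡ x _ _))) (binomialSum-*ˡ N x _)

  indicator : ℕ → ℕ → ℕ → Carrier
  indicator a₀ a _ = if does (a ℕ.≟ a₀) then 1# else 0#

  indicator-≢ : ∀ {a₀ a} b → a ≢ a₀ → indicator a₀ a b ≡ 0#
  indicator-≢ {a₀} {a} b a≢a₀ rewrite dec-false (a ℕ.≟ a₀) a≢a₀ = ≡.refl

  indicator-≡ : ∀ a b → indicator a a b ≡ 1#
  indicator-≡ a b rewrite dec-true (a ℕ.≟ a) ≡.refl = ≡.refl

  binomialSum-indicator-out : ∀ N a₀ → N < a₀ → binomialSum N (indicator a₀) ≈ 0#
  binomialSum-indicator-out N a₀ N<a₀ = trans (binomialSum-cong N vanish) (binomialSum-zero N)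
    where
    vanish : ∀ a b → a ℕ.+ b ≡ N → indicator a₀ a b ≈ 0#
    vanish a b a+b≡N with a ℕ.≟ a₀
    ... | no a≢a₀ = reflexive (indicator-≢ b a≢a₀)
    ... | yes ≡.refl = ⊥-elim (ℕ.<-irrefl ≡.refl (ℕ.≤-<-trans (ℕ.≤-trans (ℕ.m≤m+n a b) (ℕ.≤-reflexive a+b≡N)) N<a₀))

  binomialSum-indicator : ∀ N a₀ b₀ → a₀ ℕ.+ b₀ ≡ N → binomialSum N (indicator a₀) ≈ (N C b₀) × 1#
  binomialSum-indicator zero zero zero _ = sym (+-identityʳ 1#)
  binomialSum-indicator (suc N) zero .(suc N) ≡.refl = begin
    binomialSum N (λ a b → indicator 0 (suc a) b + indicator 0 a (suc b)) ≈⟨ binomialSum-cong N (λ _ _ _ → +-identityˡ _) ⟩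
    binomialSum N (indicator 0)                                       ≈⟨ binomialSum-indicator N zero N ≡.refl ⟩
    (N C N) × 1#                                                       ≡⟨ ≡.cong (_× 1#) (≡.trans (nCn≡1 N) (≡.sym (nCn≡1 (suc N)))) ⟩
    (suc N C suc N) × 1#                                               ∎
  binomialSum-indicator (suc N) (suc a₀) zero a₀+0≡N = begin
    binomialSum N (λ a b → indicator a₀ a b + indicator (suc a₀) a b) ≈⟨ binomialSum-+ N (indicator a₀) (indicator (suc a₀)) ⟩
    binomialSum N (indicator a₀) + binomialSum N (indicator (suc a₀))
      ≈⟨ +-cong (binomialSum-indicator N a₀ zero (ℕ.suc-injective a₀+0≡N))
                (binomialSum-indicator-out N (suc a₀) (s≤s (ℕ.≤-reflexive (≡.trans (≡.sym (ℕ.suc-injective a₀+0≡N)) (ℕ.+-identityʳ a₀))))) ⟩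
    (N C 0) × 1# + 0#                                                 ≈⟨ +-identityʳ _ ⟩
    (suc N C 0) × 1#                                                  ∎
  binomialSum-indicator (suc N) (suc a₀) (suc b₀) a₀+b₀≡N = begin
    binomialSum N (λ a b → indicator a₀ a b + indicator (suc a₀) a b) ≈⟨ binomialSum-+ N (indicator a₀) (indicator (suc a₀)) ⟩
    binomialSum N (indicator a₀) + binomialSum N (indicator (suc a₀))
      ≈⟨ +-cong (binomialSum-indicator N a₀ (suc b₀) (ℕ.suc-injective a₀+b₀≡N))
                (binomialSum-indicator N (suc a₀) b₀ (≡.trans (≡.sym (ℕ.+-suc a₀ b₀)) (ℕ.suc-injective a₀+b₀≡N))) ⟩
    (N C suc b₀) × 1# + (N C b₀) × 1#                                 ≈⟨ ×-homo-+ 1# (N C suc b₀) (N C b₀) ⟨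
    (N C suc b₀ ℕ.+ N C b₀) × 1#                                        ≡⟨ ≡.cong (_× 1#) (≡.trans (ℕ.+-comm (N C suc b₀) _) (nCk+nC[k+1]≡[n+1]C[k+1] N b₀)) ⟩
    (suc N C suc b₀) × 1#                                             ∎

  binomialSum-concentrated : ∀ N (φ : ℕ → ℕ → Carrier) a₀ b₀ → a₀ ℕ.+ b₀ ≡ N →
                             (∀ a b → a ℕ.+ b ≡ N → a ≢ a₀ → φ a b ≈ 0#) →
                             binomialSum N φ ≈ φ a₀ b₀ * (N C b₀) × 1#
  binomialSum-concentrated N φ a₀ b₀ a₀+b₀≡N φ≈0 = begin
    binomialSum N φ                                ≈⟨ binomialSum-cong N concentrate ⟩
    binomialSum N (λ a b → φ a₀ b₀ * indicator a₀ a b) ≈⟨ binomialSum-*ˡ N (φ a₀ b₀) (indicator a₀) ⟩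
    φ a₀ b₀ * binomialSum N (indicator a₀)         ≈⟨ *-congˡ (binomialSum-indicator N a₀ b₀ a₀+b₀≡N) ⟩
    φ a₀ b₀ * (N C b₀) × 1#                        ∎
    where
    concentrate : ∀ a b → a ℕ.+ b ≡ N → φ a b ≈ φ a₀ b₀ * indicator a₀ a b
    concentrate a b a+b≡N with a ℕ.≟ a₀
    ... | no a≢a₀ = trans (φ≈0 a b a+b≡N a≢a₀) (trans (sym (zeroʳ _)) (*-congˡ (reflexive (≡.sym (indicator-≢ b a≢a₀)))))
    ... | yes ≡.refl with ℕ.+-cancelˡ-≡ a b b₀ (≡.trans a+b≡N (≡.sym a₀+b₀≡N))
    ...   | ≡.refl = trans (sym (*-identityʳ _)) (*-congˡ (reflexive (≡.sym (indicator-≡ a b))))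

module Substitution {c ℓ} (R : CommutativeRing c ℓ) where
  open CommutativeRing R hiding (zero)
  open Poly R
  open Pairing R
  open BinomialSum R
  open import Level using (_⊔_)
  open import Algebra.Properties.Semiring.Exp semiring using () renaming (_^_ to _^ᴿ_)
  open import Algebra.Properties.CommutativeMonoid.Sum +-commutativeMonoid using (sum; sum-cong-≋; sum-replicate-zero; ∑-distrib-+)
  open import Algebra.Properties.Semiring.Sum semiring using (*-distribˡ-sum)
  open import Algebra.Solver.Ring.NaturalCoefficients.Default commutativeSemiring using (solve; _:+_; _:*_; _:=_)
  open import Relation.Binary.Reasoning.Setoid setoid
  open import Data.Fin using (_≟_)
  open import Data.List.Membership.Propositional using (_∈_; _∉_)
  open import Data.List.Membership.Propositional.Properties using (∈-allFin)
  open import Data.List.Relation.Unary.Any using (here; there)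
  open import Data.List.Relation.Unary.All.Properties using (All¬⇒¬Any)
  open import Data.List.Relation.Unary.AllPairs using (_∷_)
  open import Data.List.Relation.Unary.Unique.Propositional using (Unique)
  open import Data.List.Relation.Unary.Unique.Propositional.Properties using (allFin⁺)

  foldr-tabulate : ∀ {m n} (f : Fin n → Carrier) (σ : Fin m → Fin n) →
                   List.foldr (λ i s → f i + s) 0# (List.tabulate σ) ≡ sum (f ∘ σ)
  foldr-tabulate {zero} f σ = ≡.refl
  foldr-tabulate {suc m} f σ = ≡.cong (f (σ Fin.zero) +_) (foldr-tabulate f (σ ∘ Fin.suc))

  sum-single : ∀ {m} (f : Fin m → Carrier) k → (∀ j → j ≢ k → f j ≈ 0#) → sum f ≈ f k
  sum-single {suc m} f Fin.zero f≈0 =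
    trans (+-congˡ (trans (sum-cong-≋ (λ j → f≈0 (Fin.suc j) λ ())) (sum-replicate-zero m))) (+-identityʳ _)
  sum-single {suc m} f (Fin.suc k) f≈0 =
    trans (+-cong (f≈0 Fin.zero λ ()) (sum-single (f ∘ Fin.suc) k (λ j j≢k → f≈0 (Fin.suc j) (j≢k ∘ Finₚ.suc-injective))))
          (+-identityˡ _)

  module _ {n : ℕ} where

    idM-same : ∀ (k : Fin n) → idM k k ≈ 1#
    idM-same k with k ≟ k
    ... | yes _ = refl
    ... | no k≢k = ⊥-elim (k≢k ≡.refl)

    idM-other : ∀ {k l : Fin n} → k ≢ l → idM k l ≈ 0#
    idM-other {k} {l} k≢l with k ≟ l
    ... | yes k≡l = ⊥-elim (k≢l k≡l)
    ... | no _ = refl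

    sum-idM : ∀ k (X : Fin n → Carrier) → sum (λ m → idM k m * X m) ≈ X k
    sum-idM k X = trans (sum-single _ k (λ j j≢k → trans (*-congʳ (idM-other (j≢k ∘ ≡.sym))) (zeroˡ _)))
                        (trans (*-congʳ (idM-same k)) (*-identityˡ _))

    sum-scaled-idM : ∀ k x (X : Fin n → Carrier) → sum (λ m → (x * idM k m) * X m) ≈ x * X k
    sum-scaled-idM k x X = begin
      sum (λ m → (x * idM k m) * X m) ≈⟨ sum-cong-≋ {n} (λ m → *-assoc x _ _) ⟩
      sum (λ m → x * (idM k m * X m)) ≈⟨ *-distribˡ-sum {n} x (λ m → idM k m * X m) ⟨
      x * sum (λ m → idM k m * X m)   ≈⟨ *-congˡ (sum-idM k X) ⟩
      x * X k                          ∎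

    sum-idM-plus : ∀ k j y (X : Fin n → Carrier) → sum (λ m → (idM k m + y * idM j m) * X m) ≈ X k + y * X j
    sum-idM-plus k j y X = begin
      sum (λ m → (idM k m + y * idM j m) * X m)                      ≈⟨ sum-cong-≋ {n} (λ m → distribʳ (X m) _ _) ⟩
      sum (λ m → idM k m * X m + (y * idM j m) * X m)                ≈⟨ ∑-distrib-+ (λ m → idM k m * X m) _ ⟩
      sum (λ m → idM k m * X m) + sum (λ m → (y * idM j m) * X m)    ≈⟨ +-cong (sum-idM k X) (sum-scaled-idM j y X) ⟩
      X k + y * X j                                                   ∎

    *M-entry : ∀ (A B : Matrix n) k l → (A *M B) k l ≡ sum (λ m → A k m * B m l)
    *M-entry A B k l = foldr-tabulate (λ m → A k m * B m l) (λ m → m)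

    diagonal : (Fin n → Carrier) → Matrix n
    diagonal w k m = w k * idM k m

    diagonal-*M : ∀ w w′ → (∀ k → w k * w′ k ≈ 1#) → (diagonal w *M diagonal w′) ≈M idM
    diagonal-*M w w′ ww′≈1 k l = begin
      (diagonal w *M diagonal w′) k l                  ≡⟨ *M-entry (diagonal w) (diagonal w′) k l ⟩
      sum (λ m → (w k * idM k m) * diagonal w′ m l)   ≈⟨ sum-scaled-idM k (w k) (λ m → diagonal w′ m l) ⟩
      w k * (w′ k * idM k l)                          ≈⟨ *-assoc _ _ _ ⟨
      (w k * w′ k) * idM k l                          ≈⟨ *-congʳ (ww′≈1 k) ⟩
      1# * idM k l                                    ≈⟨ *-identityˡ _ ⟩
      idM k l                                         ∎

    transvection : Fin n → Fin n → Carrier → Matrix n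
    transvection i j s k m = idM k m + (s * idM k i) * idM j m

    transvection-*M : ∀ {i j} → i ≢ j → ∀ s s′ → s + s′ ≈ 0# → (transvection i j s *M transvection i j s′) ≈M idM
    transvection-*M {i} {j} i≢j s s′ s+s′≈0 k l = begin
      (transvection i j s *M transvection i j s′) k l                    ≡⟨ *M-entry (transvection i j s) (transvection i j s′) k l ⟩
      sum (λ m → (idM k m + (s * idM k i) * idM j m) * transvection i j s′ m l)
        ≈⟨ sum-idM-plus k j (s * idM k i) (λ m → transvection i j s′ m l) ⟩
      transvection i j s′ k l + (s * idM k i) * transvection i j s′ j l ≈⟨ +-congˡ (*-congˡ row-j) ⟩
      (idM k l + (s′ * idM k i) * idM j l) + (s * idM k i) * idM j l     ≈⟨ collect (idM k l) s s′ (idM k i) (idM j l) ⟩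
      idM k l + (s + s′) * (idM k i * idM j l)                           ≈⟨ +-congˡ (trans (*-congʳ s+s′≈0) (zeroˡ _)) ⟩
      idM k l + 0#                                                       ≈⟨ +-identityʳ _ ⟩
      idM k l                                                            ∎
      where
      row-j : transvection i j s′ j l ≈ idM j l
      row-j = trans (+-congˡ (trans (*-congʳ (trans (*-congˡ (idM-other (i≢j ∘ ≡.sym))) (zeroʳ s′))) (zeroˡ _))) (+-identityʳ _)
      collect : ∀ a s s′ b c → (a + (s′ * b) * c) + (s * b) * c ≈ a + (s + s′) * (b * c)
      collect = solve 5 (λ a s s′ b c → (a :+ (s′ :* b) :* c) :+ (s :* b) :* c := a :+ (s :+ s′) :* (b :* c)) refl

    pairing-linForm : ∀ g k φ → pairing (linForm g k) φ ≈ sum (λ m → g k m * φ (unitExp m))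
    pairing-linForm g k φ = reflexive (≡.trans (pairing-map (List.allFin n)) (foldr-tabulate (λ m → g k m * φ (unitExp m)) (λ m → m)))
      where
      pairing-map : ∀ ms → pairing (List.map (λ m → (g k m , unitExp m)) ms) φ ≡ List.foldr (λ m s → g k m * φ (unitExp m) + s) 0# ms
      pairing-map [] = ≡.refl
      pairing-map (m ∷ ms) = ≡.cong (g k m * φ (unitExp m) +_) (pairing-map ms)

    unitExp≡single : ∀ (k : Fin n) → unitExp k ≡ single k 1
    unitExp≡single k = ≗-lookup⇒≡ _ _ entry
      where
      lookup-via : ∀ {f : Fin n → ℕ} {v} → v ≡ tabulate f → ∀ l → lookup v l ≡ f l
      lookup-via ≡.refl l = Vecₚ.lookup∘tabulate _ l
      entry : ∀ l → lookup (unitExp k) l ≡ lookup (single k 1) l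
      entry l with k ≟ l | lookup-via {v = unitExp k} ≡.refl l
      ... | yes ≡.refl | unitExp-k = ≡.trans unitExp-k (≡.sym (lookup-single-same k 1))
      ... | no k≢l | unitExp-l = ≡.trans unitExp-l (≡.sym (lookup-single-other 1 k≢l))

    FixesAllBut : Matrix n → Fin n → Set (c ⊔ ℓ)
    FixesAllBut g i = ∀ k → k ≢ i → ∀ φ → pairing (linForm g k) φ ≈ φ (unitExp k)

    scaling : Fin n → Carrier → Matrix n
    scaling i a = diagonal λ k → if does (k ≟ i) then a else 1#

    linForm-scaling-i : ∀ i a φ → pairing (linForm (scaling i a) i) φ ≈ a * φ (unitExp i)
    linForm-scaling-i i a φ with pairing-linForm (scaling i a) i φ
    ... | linForm≈sum rewrite dec-true (i ≟ i) ≡.refl = trans linForm≈sum (sum-scaled-idM i a _)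

    scaling-fixes : ∀ i a → FixesAllBut (scaling i a) i
    scaling-fixes i a k k≢i φ with pairing-linForm (scaling i a) k φ
    ... | linForm≈sum rewrite dec-false (k ≟ i) k≢i = trans linForm≈sum (trans (sum-scaled-idM k 1# _) (*-identityˡ _))

    scaling-invertible : ∀ i {a b} → a * b ≈ 1# → IsInvertible (scaling i a)
    scaling-invertible i {a} {b} ab≈1 = scaling i b , diagonal-*M _ _ (inverse ab≈1) , diagonal-*M _ _ (inverse (trans (*-comm b a) ab≈1))
      where
      inverse : ∀ {x y} → x * y ≈ 1# → ∀ k → (if does (k ≟ i) then x else 1#) * (if does (k ≟ i) then y else 1#) ≈ 1#
      inverse xy≈1 k with does (k ≟ i)
      ... | true = xy≈1
      ... | false = *-identityˡ 1#

    linForm-transvection : ∀ i j s k φ → pairing (linForm (transvection i j s) k) φ ≈ φ (unitExp k) + (s * idM k i) * φ (unitExp j)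
    linForm-transvection i j s k φ = trans (pairing-linForm (transvection i j s) k φ) (sum-idM-plus k j (s * idM k i) _)

    linForm-transvection-i : ∀ i j φ → pairing (linForm (transvection i j 1#) i) φ ≈ φ (unitExp i) + φ (unitExp j)
    linForm-transvection-i i j φ =
      trans (linForm-transvection i j 1# i φ) (+-congˡ (trans (*-congʳ (trans (*-identityˡ _) (idM-same i))) (*-identityˡ _)))

    transvection-fixes : ∀ i j s → FixesAllBut (transvection i j s) i
    transvection-fixes i j s k k≢i φ = trans (linForm-transvection i j s k φ)
      (trans (+-congˡ (trans (*-congʳ (trans (*-congˡ (idM-other k≢i)) (zeroʳ s))) (zeroˡ _))) (+-identityʳ _))

    transvection-invertible : ∀ {i j} → i ≢ j → IsInvertible (transvection i j 1#)
    transvection-invertible {i} {j} i≢j = transvection i j (- 1#) ,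
      transvection-*M i≢j 1# (- 1#) (-‿inverseʳ 1#) , transvection-*M i≢j (- 1#) 1# (-‿inverseˡ 1#)

    pairing-^P-monomial : ∀ L x k → (∀ φ → pairing L φ ≈ x * φ (unitExp k)) →
                          ∀ N h → pairing (L ^P N) h ≈ x ^ᴿ N * h (single k N)
    pairing-^P-monomial L x k L≈ zero h =
      trans (pairing-1P h) (trans (reflexive (≡.cong h (≡.sym (single-zero k)))) (sym (*-identityˡ _)))
    pairing-^P-monomial L x k L≈ (suc N) h = begin
      pairing (L *P (L ^P N)) h                   ≈⟨ pairing-*P L (L ^P N) h ⟩
      pairing (L ^P N) (adjoint L h)              ≈⟨ pairing-^P-monomial L x k L≈ N (adjoint L h) ⟩
      x ^ᴿ N * adjoint L h (single k N)           ≈⟨ *-congˡ (L≈ _) ⟩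
      x ^ᴿ N * (x * h (unitExp k ⊕ single k N))   ≡⟨ ≡.cong (λ v → x ^ᴿ N * (x * h v)) (≡.trans (≡.cong (_⊕ single k N) (unitExp≡single k)) (single-⊕ k 1 N)) ⟩
      x ^ᴿ N * (x * h (single k (suc N)))         ≈⟨ x∙yz≈y∙xz (x ^ᴿ N) x _ ⟩
      x * (x ^ᴿ N * h (single k (suc N)))         ≈⟨ *-assoc _ _ _ ⟨
      x ^ᴿ suc N * h (single k (suc N))           ∎
      where open import Algebra.Properties.CommutativeSemigroup *-commutativeSemigroup using (x∙yz≈y∙xz)

    pairing-^P-binomial : ∀ L i j → (∀ φ → pairing L φ ≈ φ (unitExp i) + φ (unitExp j)) →
                          ∀ N h → pairing (L ^P N) h ≈ binomialSum N (λ a b → h (single i a ⊕ single j b))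
    pairing-^P-binomial L i j L≈ zero h = trans (pairing-1P h)
      (reflexive (≡.cong h (≡.sym (≡.trans (≡.cong₂ _⊕_ (single-zero i) (single-zero j)) (⊕-identityˡ 𝟎)))))
    pairing-^P-binomial L i j L≈ (suc N) h = begin
      pairing (L *P (L ^P N)) h                                      ≈⟨ pairing-*P L (L ^P N) h ⟩
      pairing (L ^P N) (adjoint L h)                                 ≈⟨ pairing-^P-binomial L i j L≈ N (adjoint L h) ⟩
      binomialSum N (λ a b → adjoint L h (single i a ⊕ single j b)) ≈⟨ binomialSum-cong N (λ a b _ → trans (L≈ _) (+-cong (step-i a b) (step-j a b))) ⟩
      binomialSum (suc N) (λ a b → h (single i a ⊕ single j b))     ∎
      where
      step-i : ∀ a b → h (unitExp i ⊕ (single i a ⊕ single j b)) ≈ h (single i (suc a) ⊕ single j b)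
      step-i a b = reflexive (≡.cong h (≡.trans (≡.sym (⊕-assoc (unitExp i) _ _))
        (≡.cong (_⊕ single j b) (≡.trans (≡.cong (_⊕ single i a) (unitExp≡single i)) (single-⊕ i 1 a)))))
      step-j : ∀ a b → h (unitExp j ⊕ (single i a ⊕ single j b)) ≈ h (single i a ⊕ single j (suc b))
      step-j a b = reflexive (≡.cong h (≡.trans (⊕-exchange (unitExp j) _ _)
        (≡.cong (single i a ⊕_) (≡.trans (≡.cong (_⊕ single j b) (unitExp≡single j)) (single-⊕ j 1 b)))))

    image : Matrix n → Exponent n → List (Fin n) → Polynomial n
    image g d ks = List.foldr (λ k p → (linForm g k ^P lookup d k) *P p) 1P ks

    coeff-act : ∀ g f e → coeff (act g f) e ≈ pairing f (λ d → pairing (image g d (List.allFin n)) (δ e))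
    coeff-act g f e = trans (coeff≈pairing-δ (act g f) e) (pairing-concatMap _ f (δ e) _ (λ a d → pairing-scaleP a (image g d (List.allFin n)) (δ e)))

    module _ (g : Matrix n) (i : Fin n) (fixes : FixesAllBut g i) (d : Exponent n) where

      private
        A : Fin n → Polynomial n
        A k = linForm g k ^P lookup d k

        shifted : List (Fin n) → Exponent n
        shifted ks = assemble ks (d [ i ]≔ 0)

        adjoint-fixed : ∀ k → k ≢ i → ∀ h v → adjoint (A k) h v ≈ h (single k (lookup d k) ⊕ v)
        adjoint-fixed k k≢i h v = trans (pairing-^P-monomial (linForm g k) 1# k (λ φ → trans (fixes k k≢i φ) (sym (*-identityˡ _))) (lookup d k) _)
                                        (trans (*-congʳ (1#^N≈1# (lookup d k))) (*-identityˡ _))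
          where
          1#^N≈1# : ∀ N → 1# ^ᴿ N ≈ 1#
          1#^N≈1# zero = refl
          1#^N≈1# (suc N) = trans (*-identityˡ _) (1#^N≈1# N)

        shifted-∷ : ∀ k ks → k ≢ i → single k (lookup d k) ⊕ shifted ks ≡ shifted (k ∷ ks)
        shifted-∷ k ks k≢i = ≡.cong (λ a → single k a ⊕ shifted ks) (≡.sym (Vecₚ.lookup∘updateAt′ k i k≢i d))

        shifted-∷-i : ∀ ks → shifted ks ≡ shifted (i ∷ ks)
        shifted-∷-i ks = ≡.sym (≡.trans (≡.cong (λ a → single i a ⊕ shifted ks) (Vecₚ.lookup∘updateAt i d))
                                        (≡.trans (≡.cong (_⊕ shifted ks) (single-zero i)) (⊕-identityˡ _)))

        image-without-i : ∀ ks → i ∉ ks → ∀ h → pairing (image g d ks) h ≈ h (shifted ks)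
        image-without-i [] _ h = pairing-1P h
        image-without-i (k ∷ ks) i∉ h = begin
          pairing (A k *P image g d ks) h          ≈⟨ pairing-*P (A k) (image g d ks) h ⟩
          pairing (image g d ks) (adjoint (A k) h) ≈⟨ image-without-i ks (i∉ ∘ there) _ ⟩
          adjoint (A k) h (shifted ks)             ≈⟨ adjoint-fixed k k≢i h (shifted ks) ⟩
          h (single k (lookup d k) ⊕ shifted ks)   ≡⟨ ≡.cong h (shifted-∷ k ks k≢i) ⟩
          h (shifted (k ∷ ks))                     ∎
          where
          k≢i : k ≢ i
          k≢i k≡i = i∉ (here (≡.sym k≡i))

        image-with-i : ∀ ks → Unique ks → i ∈ ks → ∀ h → pairing (image g d ks) h ≈ adjoint (A i) h (shifted ks)
        image-with-i (k ∷ ks) (k∉ks ∷ unique) i∈ h with k ≟ i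
        ... | yes ≡.refl = begin
          pairing (A i *P image g d ks) h          ≈⟨ pairing-*P (A i) (image g d ks) h ⟩
          pairing (image g d ks) (adjoint (A i) h) ≈⟨ image-without-i ks (All¬⇒¬Any k∉ks) _ ⟩
          adjoint (A i) h (shifted ks)             ≡⟨ ≡.cong (adjoint (A i) h) (shifted-∷-i ks) ⟩
          adjoint (A i) h (shifted (i ∷ ks))       ∎
        ... | no k≢i = begin
          pairing (A k *P image g d ks) h                              ≈⟨ pairing-*P (A k) (image g d ks) h ⟩
          pairing (image g d ks) (adjoint (A k) h)                     ≈⟨ image-with-i ks unique (i∈ks i∈) _ ⟩
          adjoint (A i) (adjoint (A k) h) (shifted ks)                 ≈⟨ adjoint-congʳ (A i) (shifted ks) (λ w → adjoint-fixed k k≢i h w) ⟩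
          adjoint (A i) (λ w → h (single k (lookup d k) ⊕ w)) (shifted ks) ≈⟨ adjoint-shift (A i) h _ (shifted ks) ⟩
          adjoint (A i) h (single k (lookup d k) ⊕ shifted ks)         ≡⟨ ≡.cong (adjoint (A i) h) (shifted-∷ k ks k≢i) ⟩
          adjoint (A i) h (shifted (k ∷ ks))                           ∎
          where
          i∈ks : i ∈ k ∷ ks → i ∈ ks
          i∈ks (here i≡k) = ⊥-elim (k≢i (≡.sym i≡k))
          i∈ks (there i∈ks) = i∈ks

      pairing-image : ∀ h → pairing (image g d (List.allFin n)) h ≈ adjoint (linForm g i ^P lookup d i) h (d [ i ]≔ 0)
      pairing-image h = trans (image-with-i (List.allFin n) (allFin⁺ n) (∈-allFin i) h)
                              (reflexive (≡.cong (adjoint (A i) h) (assemble-allFin (d [ i ]≔ 0))))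

    pairing-weighted-δ : ∀ f e (w : Exponent n → Carrier) → pairing f (λ d → w d * δ e d) ≈ w e * coeff f e
    pairing-weighted-δ f e w = begin
      pairing f (λ d → w d * δ e d) ≈⟨ pairing-congʳ f weight-at-e ⟩
      pairing f (λ d → w e * δ e d) ≈⟨ pairing-*ʳ f (w e) (δ e) ⟩
      w e * pairing f (δ e)         ≈⟨ *-congˡ (coeff≈pairing-δ f e) ⟨
      w e * coeff f e               ∎
      where
      weight-at-e : ∀ d → w d * δ e d ≈ w e * δ e d
      weight-at-e d with Vecₚ.≡-dec ℕ._≟_ d e
      ... | yes ≡.refl = refl
      ... | no _ = trans (zeroʳ _) (sym (zeroʳ _))

    coeff-act-scaling : ∀ i a f e → coeff (act (scaling i a) f) e ≈ a ^ᴿ lookup e i * coeff f e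
    coeff-act-scaling i a f e = begin
      coeff (act (scaling i a) f) e                                       ≈⟨ coeff-act (scaling i a) f e ⟩
      pairing f (λ d → pairing (image (scaling i a) d (List.allFin n)) (δ e)) ≈⟨ pairing-congʳ f image-scaling ⟩
      pairing f (λ d → a ^ᴿ lookup d i * δ e d)                           ≈⟨ pairing-weighted-δ f e (λ d → a ^ᴿ lookup d i) ⟩
      a ^ᴿ lookup e i * coeff f e                                         ∎
      where
      image-scaling : ∀ d → pairing (image (scaling i a) d (List.allFin n)) (δ e) ≈ a ^ᴿ lookup d i * δ e d
      image-scaling d = trans (pairing-image (scaling i a) i (scaling-fixes i a) d (δ e))
        (trans (pairing-^P-monomial _ a i (linForm-scaling-i i a) (lookup d i) _)
               (*-congˡ (reflexive (≡.cong (δ e) (single-⊕-cleared i d)))))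

    coeff-act-transvection : ∀ i j f t → coeff (act (transvection i j 1#) f) t ≈
      pairing f (λ d → binomialSum (lookup d i) (λ a b → δ t (single i a ⊕ single j b ⊕ (d [ i ]≔ 0))))
    coeff-act-transvection i j f t = trans (coeff-act (transvection i j 1#) f t) (pairing-congʳ f λ d →
      trans (pairing-image (transvection i j 1#) i (transvection-fixes i j 1#) d (δ t))
            (pairing-^P-binomial _ i j (linForm-transvection-i i j) (lookup d i) _))

module _ {a ℓ} (M : CommutativeMonoid a ℓ) where
  open CommutativeMonoid M
  open import Algebra.Properties.CommutativeMonoid.Sum M using (sum; sum-permute; sum-cong-≋)

  sum-invariant : ∀ {N} (e : Fin N → Carrier) → (∀ i j → e i ≈ e j → i ≡ j) →
                  (T T′ : Carrier → Carrier) → (∀ {x y} → x ≈ y → T x ≈ T y) → (∀ {x y} → x ≈ y → T′ x ≈ T′ y) →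
                  (∀ x → T (T′ x) ≈ x) → (∀ x → T′ (T x) ≈ x) →
                  (σ σ′ : Fin N → Fin N) → (∀ j → e (σ j) ≈ T (e j)) → (∀ j → e (σ′ j) ≈ T′ (e j)) →
                  sum e ≈ sum (T ∘ e)
  sum-invariant e e-injective T T′ T-cong T′-cong TT′≈id T′T≈id σ σ′ eσ≈Te eσ′≈T′e =
    trans (sum-permute e π) (sum-cong-≋ {x = e ∘ σ} {y = T ∘ e} eσ≈Te)
    where
    π : Perm.Permutation′ _
    π = Perm.permutation σ σ′
      (λ j → e-injective _ _ (trans (eσ≈Te (σ′ j)) (trans (T-cong (eσ′≈T′e j)) (TT′≈id (e j)))))
      (λ j → e-injective _ _ (trans (eσ′≈T′e (σ j)) (trans (T′-cong (eσ≈Te j)) (T′T≈id (e j)))))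

module FiniteField {c ℓ} (F : CommutativeRing c ℓ) (isField : IsField F) (q′ : ℕ) (card : HasCardinality F (suc q′)) where
  open CommutativeRing F hiding (zero)
  open import Algebra.Properties.Semiring.Exp semiring using (^-assocʳ; ^-congˡ) renaming (_^_ to _^ᴿ_)
  open import Algebra.Properties.Semiring.Mult semiring using (_×_; ×-homo-+; ×1-homo-*)
  open import Algebra.Properties.CommutativeMonoid.Sum +-commutativeMonoid using (sum; sum-replicate; ∑-distrib-+)
  open import Algebra.Properties.CommutativeMonoid.Sum *-commutativeMonoid using ()
    renaming (sum to product; sum-replicate to product-replicate; ∑-distrib-+ to ∏-distrib-*)
  open import Algebra.Solver.Ring.NaturalCoefficients.Default commutativeSemiring using (solve; _:+_; _:*_; _:=_)
  open import Relation.Binary.Reasoning.Setoid setoid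

  private
    enum : Fin (suc q′) → Carrier
    enum = proj₁ card

    enum-injective : ∀ i j → enum i ≈ enum j → i ≡ j
    enum-injective = proj₁ (proj₂ card)

    index : Carrier → Fin (suc q′)
    index x = proj₁ (proj₂ (proj₂ card) x)

    enum-index : ∀ x → enum (index x) ≈ x
    enum-index x = proj₂ (proj₂ (proj₂ card) x)

  _≈?_ : ∀ x y → Dec (x ≈ y)
  x ≈? y with index x Fin.≟ index y
  ... | yes ix≡iy = yes (trans (sym (enum-index x)) (trans (reflexive (≡.cong enum ix≡iy)) (enum-index y)))
  ... | no ix≢iy = no (λ x≈y → ix≢iy (enum-injective _ _ (trans (enum-index x) (trans x≈y (sym (enum-index y))))))

  1≉0 : ¬ (1# ≈ 0#)
  1≉0 1≈0 = proj₁ isField (sym 1≈0)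

  -1≉0 : ¬ (- 1# ≈ 0#)
  -1≉0 -1≈0 = 1≉0 (trans (sym (+-identityʳ 1#)) (trans (+-congˡ (sym -1≈0)) (-‿inverseʳ 1#)))

  inverse : ∀ x → ¬ (x ≈ 0#) → Carrier
  inverse x x≉0 = proj₁ (proj₂ isField x x≉0)

  inverse-*ʳ : ∀ x x≉0 → x * inverse x x≉0 ≈ 1#
  inverse-*ʳ x x≉0 = proj₂ (proj₂ isField x x≉0)

  inverse-*ˡ : ∀ x x≉0 → inverse x x≉0 * x ≈ 1#
  inverse-*ˡ x x≉0 = trans (*-comm _ _) (inverse-*ʳ x x≉0)

  *-cancelˡ : ∀ {x y z} → ¬ (x ≈ 0#) → x * y ≈ x * z → y ≈ z
  *-cancelˡ {x} {y} {z} x≉0 xy≈xz = begin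
    y                         ≈⟨ *-identityˡ y ⟨
    1# * y                    ≈⟨ *-congʳ (inverse-*ˡ x x≉0) ⟨
    (inverse x x≉0 * x) * y   ≈⟨ *-assoc _ _ _ ⟩
    inverse x x≉0 * (x * y)   ≈⟨ *-congˡ xy≈xz ⟩
    inverse x x≉0 * (x * z)   ≈⟨ *-assoc _ _ _ ⟨
    (inverse x x≉0 * x) * z   ≈⟨ *-congʳ (inverse-*ˡ x x≉0) ⟩
    1# * z                    ≈⟨ *-identityˡ z ⟩
    z                         ∎

  x≉0∧xy≈0⇒y≈0 : ∀ {x y} → ¬ (x ≈ 0#) → x * y ≈ 0# → y ≈ 0#
  x≉0∧xy≈0⇒y≈0 {x} x≉0 xy≈0 = *-cancelˡ x≉0 (trans xy≈0 (sym (zeroʳ x)))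

  *-nonzero : ∀ {x y} → ¬ (x ≈ 0#) → ¬ (y ≈ 0#) → ¬ (x * y ≈ 0#)
  *-nonzero x≉0 y≉0 xy≈0 = y≉0 (x≉0∧xy≈0⇒y≈0 x≉0 xy≈0)

  ^-nonzero : ∀ {x} → ¬ (x ≈ 0#) → ∀ k → ¬ (x ^ᴿ k ≈ 0#)
  ^-nonzero x≉0 zero = 1≉0
  ^-nonzero x≉0 (suc k) = *-nonzero x≉0 (^-nonzero x≉0 k)

  inverse-nonzero : ∀ x x≉0 → ¬ (inverse x x≉0 ≈ 0#)
  inverse-nonzero x x≉0 x⁻¹≈0 = 1≉0 (trans (sym (inverse-*ʳ x x≉0)) (trans (*-congˡ x⁻¹≈0) (zeroʳ x)))

  card×1≈0 : suc q′ × 1# ≈ 0#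
  card×1≈0 = identityˡ-unique _ _ (sym translation-invariance)
    where
    open import Algebra.Properties.Group +-group using (identityˡ-unique)
    translation-invariance : sum enum ≈ suc q′ × 1# + sum enum
    translation-invariance = begin
      sum enum                                ≈⟨ sum-invariant +-commutativeMonoid enum enum-injective (1# +_) (_+ - 1#) +-congˡ +-congʳ
                                                   1+[x-1]≈x [1+x]-1≈x
                                                   (λ j → index (1# + enum j)) (λ j → index (enum j + - 1#))
                                                   (λ j → enum-index _) (λ j → enum-index _) ⟩
      sum (λ j → 1# + enum j)                 ≈⟨ ∑-distrib-+ (λ _ → 1#) enum ⟩
      sum (λ (_ : Fin (suc q′)) → 1#) + sum enum ≈⟨ +-congʳ (sum-replicate (suc q′)) ⟩
      suc q′ × 1# + sum enum                  ∎
      where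
      1+[x-1]≈x : ∀ x → 1# + (x + - 1#) ≈ x
      1+[x-1]≈x x = trans (+-comm _ _) (trans (+-assoc x (- 1#) 1#) (trans (+-congˡ (-‿inverseˡ 1#)) (+-identityʳ x)))
      [1+x]-1≈x : ∀ x → (1# + x) + - 1# ≈ x
      [1+x]-1≈x x = trans (+-congʳ (+-comm 1# x)) (trans (+-assoc x 1# (- 1#)) (trans (+-congˡ (-‿inverseʳ 1#)) (+-identityʳ x)))

  private
    zeroIndex : Fin (suc q′)
    zeroIndex = index 0#

    nonzero : Fin q′ → Carrier
    nonzero j = enum (Fin.punchIn zeroIndex j)

    nonzero-injective : ∀ i j → nonzero i ≈ nonzero j → i ≡ j
    nonzero-injective i j e = Finₚ.punchIn-injective zeroIndex i j (enum-injective _ _ e)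

    nonzero-≉0 : ∀ j → ¬ (nonzero j ≈ 0#)
    nonzero-≉0 j e = Finₚ.punchInᵢ≢i zeroIndex j (enum-injective _ _ (trans e (sym (enum-index 0#))))

    nonzeroIndex : ∀ x → ¬ (x ≈ 0#) → Fin q′
    nonzeroIndex x x≉0 = Fin.punchOut {i = zeroIndex} {j = index x}
      (λ e → x≉0 (trans (sym (enum-index x)) (trans (reflexive (≡.cong enum (≡.sym e))) (enum-index 0#))))

    nonzero-index : ∀ x x≉0 → nonzero (nonzeroIndex x x≉0) ≈ x
    nonzero-index x x≉0 = trans (reflexive (≡.cong enum (Finₚ.punchIn-punchOut _))) (enum-index x)

  product-nonzero : ∀ {N} (g : Fin N → Carrier) → (∀ j → ¬ (g j ≈ 0#)) → ¬ (product g ≈ 0#)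
  product-nonzero {zero} g g≉0 = 1≉0
  product-nonzero {suc N} g g≉0 = *-nonzero (g≉0 Fin.zero) (product-nonzero (g ∘ Fin.suc) (g≉0 ∘ Fin.suc))

  unit^[q-1]≈1 : ∀ a → ¬ (a ≈ 0#) → a ^ᴿ q′ ≈ 1#
  unit^[q-1]≈1 a a≉0 = *-cancelˡ (product-nonzero nonzero nonzero-≉0)
    (trans (*-comm _ _) (trans (sym dilation-invariance) (sym (*-identityʳ _))))
    where
    a⁻¹ = inverse a a≉0
    dilate : ∀ {x} → ¬ (x ≈ 0#) → ∀ j → ¬ (x * nonzero j ≈ 0#)
    dilate x≉0 j = *-nonzero x≉0 (nonzero-≉0 j)
    dilation-invariance : product nonzero ≈ a ^ᴿ q′ * product nonzero
    dilation-invariance = begin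
      product nonzero                        ≈⟨ sum-invariant *-commutativeMonoid nonzero nonzero-injective (a *_) (a⁻¹ *_) *-congˡ *-congˡ
                                                  (λ x → trans (sym (*-assoc _ _ _)) (trans (*-congʳ (inverse-*ʳ a a≉0)) (*-identityˡ x)))
                                                  (λ x → trans (sym (*-assoc _ _ _)) (trans (*-congʳ (inverse-*ˡ a a≉0)) (*-identityˡ x)))
                                                  (λ j → nonzeroIndex _ (dilate a≉0 j)) (λ j → nonzeroIndex _ (dilate (inverse-nonzero a a≉0) j))
                                                  (λ j → nonzero-index _ (dilate a≉0 j)) (λ j → nonzero-index _ (dilate (inverse-nonzero a a≉0) j)) ⟩
      product (λ j → a * nonzero j)          ≈⟨ ∏-distrib-* (λ _ → a) nonzero ⟩
      product (λ (_ : Fin q′) → a) * product nonzero ≈⟨ *-congʳ (product-replicate q′) ⟩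
      a ^ᴿ q′ * product nonzero              ∎

  eval : List Carrier → Carrier → Carrier
  eval [] x = 0#
  eval (c ∷ cs) x = c + x * eval cs x

  quotient : List Carrier → Carrier → List Carrier
  quotient [] a = []
  quotient (c ∷ []) a = []
  quotient (c ∷ c′ ∷ cs) a = eval (c′ ∷ cs) a ∷ quotient (c′ ∷ cs) a

  length-quotient : ∀ P a → List.length (quotient P a) ≡ ℕ.pred (List.length P)
  length-quotient [] a = ≡.refl
  length-quotient (c ∷ []) a = ≡.refl
  length-quotient (c ∷ c′ ∷ cs) a = ≡.cong suc (length-quotient (c′ ∷ cs) a)

  eval-division : ∀ P a x → eval P x ≈ (x - a) * eval (quotient P a) x + eval P a
  eval-division [] a x = sym (trans (+-identityʳ _) (zeroʳ _))
  eval-division (c ∷ []) a x = begin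
    c + x * 0#                  ≈⟨ +-congˡ (trans (zeroʳ x) (sym (zeroʳ a))) ⟩
    c + a * 0#                  ≈⟨ +-identityˡ _ ⟨
    0# + (c + a * 0#)           ≈⟨ +-congʳ (zeroʳ _) ⟨
    (x - a) * 0# + (c + a * 0#) ∎
  eval-division (c ∷ c′ ∷ cs) a x = begin
    c + x * eval (c′ ∷ cs) x                             ≈⟨ +-congˡ (*-congˡ (eval-division (c′ ∷ cs) a x)) ⟩
    c + x * ((x - a) * Z + Y)                            ≈⟨ +-identityʳ _ ⟨
    (c + x * ((x - a) * Z + Y)) + 0#                     ≈⟨ +-congˡ (trans (*-congʳ (-‿inverseˡ a)) (zeroˡ Y)) ⟨
    (c + x * ((x - a) * Z + Y)) + (- a + a) * Y          ≈⟨ regroup c x (- a) Z Y a ⟩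
    (x - a) * (Y + x * Z) + (c + a * Y)                  ∎
    where
    Y = eval (c′ ∷ cs) a
    Z = eval (quotient (c′ ∷ cs) a) x
    regroup : ∀ c x na Z Y a → (c + x * ((x + na) * Z + Y)) + (na + a) * Y ≈ (x + na) * (Y + x * Z) + (c + a * Y)
    regroup = solve 6 (λ c x na Z Y a → (c :+ x :* ((x :+ na) :* Z :+ Y)) :+ (na :+ a) :* Y
                                      := (x :+ na) :* (Y :+ x :* Z) :+ (c :+ a :* Y)) refl

  vanishes-everywhere : ∀ M P → List.length P ≤ M → (ps : Fin M → Carrier) → (∀ i j → ps i ≈ ps j → i ≡ j) →
                        (∀ i → eval P (ps i) ≈ 0#) → ∀ x → eval P x ≈ 0#
  vanishes-everywhere zero [] _ ps ps-injective roots x = refl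
  vanishes-everywhere (suc M) P |P|≤1+M ps ps-injective roots x = begin
    eval P x                                    ≈⟨ eval-division P (ps Fin.zero) x ⟩
    (x - ps Fin.zero) * eval Q x + eval P (ps Fin.zero)
      ≈⟨ +-cong (*-congˡ (vanishes-everywhere M Q |Q|≤M (ps ∘ Fin.suc) (λ i j → Finₚ.suc-injective ∘ ps-injective _ _) Q-roots x))
                (roots Fin.zero) ⟩
    (x - ps Fin.zero) * 0# + 0#                 ≈⟨ trans (+-identityʳ _) (zeroʳ _) ⟩
    0#                                          ∎
    where
    Q = quotient P (ps Fin.zero)
    |Q|≤M : List.length Q ≤ M
    |Q|≤M = ≡.subst (_≤ M) (≡.sym (length-quotient P (ps Fin.zero))) (ℕ.pred-mono-≤ |P|≤1+M)
    Q-roots : ∀ i → eval Q (ps (Fin.suc i)) ≈ 0#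
    Q-roots i = x≉0∧xy≈0⇒y≈0 distinct (trans (sym (+-identityʳ _)) (trans (+-congˡ (sym (roots Fin.zero)))
                  (trans (sym (eval-division P (ps Fin.zero) (ps (Fin.suc i)))) (roots (Fin.suc i)))))
      where
      open import Algebra.Properties.Group +-group using (x∙y⁻¹≈ε⇒x≈y)
      distinct : ¬ (ps (Fin.suc i) - ps Fin.zero ≈ 0#)
      distinct d≈0 with ps-injective _ _ (x∙y⁻¹≈ε⇒x≈y _ _ d≈0)
      ... | ()

  monomial : ℕ → List Carrier
  monomial zero = 1# ∷ []
  monomial (suc r) = 0# ∷ monomial r

  length-monomial : ∀ r → List.length (monomial r) ≡ suc r
  length-monomial zero = ≡.refl
  length-monomial (suc r) = ≡.cong suc (length-monomial r)

  eval-monomial : ∀ r x → eval (monomial r) x ≈ x ^ᴿ r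
  eval-monomial zero x = trans (+-congˡ (zeroʳ x)) (+-identityʳ 1#)
  eval-monomial (suc r) x = trans (+-identityˡ _) (*-congˡ (eval-monomial r x))

  -- X^(r+1) - 1 has at most r + 1 roots, but there are q - 1 nonzero elements.
  ¬all-roots-of-unity : ∀ r → suc (suc r) ≤ q′ → ¬ (∀ a → ¬ (a ≈ 0#) → a ^ᴿ suc r ≈ 1#)
  ¬all-roots-of-unity r 2+r≤q′ roots = -1≉0 -1≈0
    where
    P : List Carrier
    P = - 1# ∷ monomial r
    evalP : ∀ x → eval P x ≈ - 1# + x ^ᴿ suc r
    evalP x = +-congˡ (*-congˡ (eval-monomial r x))
    ps : Fin (suc (suc r)) → Carrier
    ps j = nonzero (Fin.inject≤ j 2+r≤q′)
    at-0 : eval P 0# ≈ 0#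
    at-0 = vanishes-everywhere (suc (suc r)) P (ℕ.≤-reflexive (≡.cong suc (length-monomial r))) ps
             (λ i j → Finₚ.inject≤-injective 2+r≤q′ 2+r≤q′ i j ∘ nonzero-injective _ _)
             (λ i → trans (evalP (ps i)) (trans (+-congˡ (roots (ps i) (nonzero-≉0 _))) (-‿inverseˡ 1#)))
             0#
    -1≈0 : - 1# ≈ 0#
    -1≈0 = begin
      - 1#                ≈⟨ +-identityʳ _ ⟨
      - 1# + 0#           ≈⟨ +-congˡ (zeroˡ _) ⟨
      - 1# + 0# ^ᴿ suc r  ≈⟨ evalP 0# ⟨
      eval P 0#           ≈⟨ at-0 ⟩
      0#                  ∎

  x^q≈x : ∀ a → a ^ᴿ suc q′ ≈ a
  x^q≈x a with a ≈? 0#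
  ... | yes a≈0 = trans (*-congʳ a≈0) (trans (zeroˡ _) (sym a≈0))
  ... | no a≉0 = trans (*-congˡ (unit^[q-1]≈1 a a≉0)) (*-identityʳ a)

  x^[qᵐ]≈x : ∀ m a → a ^ᴿ (suc q′ ^ m) ≈ a
  x^[qᵐ]≈x zero a = *-identityʳ a
  x^[qᵐ]≈x (suc m) a = begin
    a ^ᴿ (suc q′ ℕ.* suc q′ ^ m)    ≈⟨ ^-assocʳ a (suc q′) (suc q′ ^ m) ⟨
    (a ^ᴿ suc q′) ^ᴿ (suc q′ ^ m)   ≈⟨ ^-congˡ (suc q′ ^ m) (x^q≈x a) ⟩
    a ^ᴿ (suc q′ ^ m)               ≈⟨ x^[qᵐ]≈x m a ⟩
    a                               ∎

  module Characteristic {p k} (p-prime : Prime p) (q≡pᵏ : suc q′ ≡ p ^ k) where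

    ×1-homo-^ : ∀ m n → (m × 1#) ^ᴿ n ≈ (m ^ n) × 1#
    ×1-homo-^ m zero = sym (+-identityʳ 1#)
    ×1-homo-^ m (suc n) = trans (*-congˡ (×1-homo-^ m n)) (sym (×1-homo-* m (m ^ n)))

    p×1≈0 : p × 1# ≈ 0#
    p×1≈0 with (p × 1#) ≈? 0#
    ... | yes p×1≈0 = p×1≈0
    ... | no p×1≉0 = ⊥-elim (^-nonzero p×1≉0 k (trans (×1-homo-^ p k) (trans (reflexive (≡.cong (_× 1#) (≡.sym q≡pᵏ))) card×1≈0)))

    p∣n⇒n×1≈0 : ∀ {n} → p ∣ n → n × 1# ≈ 0#
    p∣n⇒n×1≈0 (divides z ≡.refl) = trans (×1-homo-* z p) (trans (*-congˡ p×1≈0) (zeroʳ _))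

    C-periodic : ∀ A s r → r < p ^ A → ((p ^ A ℕ.+ s) C r) × 1# ≈ (s C r) × 1#
    C-periodic A zero zero _ = reflexive (≡.cong (λ n → (n C 0) × 1#) (ℕ.+-identityʳ (p ^ A)))
    C-periodic A zero (suc r) r<pᴬ = trans (reflexive (≡.cong (λ n → (n C suc r) × 1#) (ℕ.+-identityʳ (p ^ A))))
                                            (p∣n⇒n×1≈0 (prime∣pᵃCr p-prime A (suc r) (s≤s z≤n) r<pᴬ))
    C-periodic A (suc s) zero _ = reflexive (≡.cong (λ n → (n C 0) × 1#) (ℕ.+-suc (p ^ A) s))
    C-periodic A (suc s) (suc r) r<pᴬ = begin
      ((Q ℕ.+ suc s) C suc r) × 1#                   ≡⟨ ≡.cong (λ n → (n C suc r) × 1#) (ℕ.+-suc Q s) ⟩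
      (suc (Q ℕ.+ s) C suc r) × 1#                   ≡⟨ ≡.cong (_× 1#) (≡.sym (nCk+nC[k+1]≡[n+1]C[k+1] (Q ℕ.+ s) r)) ⟩
      ((Q ℕ.+ s) C r ℕ.+ (Q ℕ.+ s) C suc r) × 1#     ≈⟨ ×-homo-+ 1# ((Q ℕ.+ s) C r) _ ⟩
      ((Q ℕ.+ s) C r) × 1# + ((Q ℕ.+ s) C suc r) × 1# ≈⟨ +-cong (C-periodic A s r (ℕ.<-trans (ℕ.n<1+n r) r<pᴬ)) (C-periodic A s (suc r) r<pᴬ) ⟩
      (s C r) × 1# + (s C suc r) × 1#                 ≈⟨ ×-homo-+ 1# (s C r) _ ⟨
      (s C r ℕ.+ s C suc r) × 1#                      ≡⟨ ≡.cong (_× 1#) (nCk+nC[k+1]≡[n+1]C[k+1] s r) ⟩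
      (suc s C suc r) × 1#                            ∎
      where
      Q = p ^ A

    module _ {A Q₂} (Q≡pᴬ : suc (suc Q₂) ≡ p ^ A) where

      [Q-1]×1≈-1 : suc Q₂ × 1# ≈ - 1#
      [Q-1]×1≈-1 = inverseʳ-unique 1# _ Q×1≈0
        where
        open import Algebra.Properties.Group +-group using (inverseʳ-unique)
        p∣Q : ∀ B → suc (suc Q₂) ≡ p ^ B → p ∣ suc (suc Q₂)
        p∣Q (suc B) Q≡pᴮ = divides (p ^ B) (≡.trans Q≡pᴮ (ℕ.*-comm p (p ^ B)))
        Q×1≈0 : suc (suc Q₂) × 1# ≈ 0#
        Q×1≈0 = p∣n⇒n×1≈0 (p∣Q A Q≡pᴬ)

      [Q-2+b]Cb×1≈0 : ∀ b → 2 ≤ b → b < suc (suc Q₂) → ((Q₂ ℕ.+ b) C b) × 1# ≈ 0#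
      [Q-2+b]Cb×1≈0 (suc zero) (s≤s ()) _
      [Q-2+b]Cb×1≈0 (suc (suc b′)) _ b<Q = begin
        ((Q₂ ℕ.+ suc (suc b′)) C suc (suc b′)) × 1# ≡⟨ ≡.cong (λ n → (n C suc (suc b′)) × 1#) (≡.trans Q₂+b≡Q+b′ (≡.cong (ℕ._+ b′) Q≡pᴬ)) ⟩
        ((p ^ A ℕ.+ b′) C suc (suc b′)) × 1#        ≈⟨ C-periodic A b′ (suc (suc b′)) (≡.subst (suc (suc b′) <_) Q≡pᴬ b<Q) ⟩
        (b′ C suc (suc b′)) × 1#                   ≡⟨ ≡.cong (_× 1#) (k>n⇒nCk≡0 (ℕ.m<n⇒m<1+n (ℕ.n<1+n b′))) ⟩
        0#                                         ∎
        where
        Q₂+b≡Q+b′ : Q₂ ℕ.+ suc (suc b′) ≡ suc (suc Q₂) ℕ.+ b′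
        Q₂+b≡Q+b′ = ≡.trans (ℕ.+-suc Q₂ (suc b′)) (≡.cong suc (ℕ.+-suc Q₂ b′))

-- Q = q^m is written 2 + Q₂, so that Q - 1 and Q - 2 involve no truncated subtraction,
-- and X is Q - q.
module InvariantMonomials {c ℓ} (F : CommutativeRing c ℓ) (isField : IsField F) (q′ : ℕ) (card : HasCardinality F (suc q′))
  {p k} (p-prime : Prime p) (q≡pᵏ : suc q′ ≡ p ^ k) (m : ℕ) {Q₂ X : ℕ}
  (Q≡qᵐ : suc (suc Q₂) ≡ suc q′ ^ m) (Q≡q+X : suc (suc Q₂) ≡ suc q′ ℕ.+ X) where

  open CommutativeRing F hiding (zero)
  open import Algebra.Properties.Semiring.Exp semiring using (^-homo-*; ^-congʳ) renaming (_^_ to _^ᴿ_)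
  open import Algebra.Properties.Semiring.Mult semiring using (_×_)
  open import Relation.Binary.Reasoning.Setoid setoid
  open Poly F
  open Pairing F
  open BinomialSum F
  open Substitution F
  open FiniteField F isField q′ card
  open Characteristic {p} {k} p-prime q≡pᵏ

  Q : ℕ
  Q = suc (suc Q₂)

  Q≡pᴬ : Q ≡ p ^ (k ℕ.* m)
  Q≡pᴬ = ≡.trans Q≡qᵐ (≡.trans (≡.cong (_^ m) q≡pᵏ) (ℕ.^-*-assoc p k m))

  unit^[Q-1]≈1 : ∀ a → ¬ (a ≈ 0#) → a ^ᴿ suc Q₂ ≈ 1#
  unit^[Q-1]≈1 a a≉0 = *-cancelˡ a≉0 (trans (trans (reflexive (≡.cong (a ^ᴿ_) Q≡qᵐ)) (x^[qᵐ]≈x m a)) (sym (*-identityʳ a)))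

  unit-exponent-above-X≡Q-1 : ∀ d → d < Q → X < d → (∀ a → ¬ (a ≈ 0#) → a ^ᴿ d ≈ 1#) → d ≡ suc Q₂
  unit-exponent-above-X≡Q-1 d d<Q X<d aᵈ≈1 with suc Q₂ ∸ d | ℕ.m+[n∸m]≡n (ℕ.≤-pred d<Q)
  ... | zero | d+0≡Q-1 = ≡.trans (≡.sym (ℕ.+-identityʳ d)) d+0≡Q-1
  ... | suc r | d+r≡Q-1 = ⊥-elim (¬all-roots-of-unity r 2+r≤q′ aʳ≈1)
    where
    aʳ≈1 : ∀ a → ¬ (a ≈ 0#) → a ^ᴿ suc r ≈ 1#
    aʳ≈1 a a≉0 = begin
      a ^ᴿ suc r              ≈⟨ *-identityˡ _ ⟨
      1# * a ^ᴿ suc r         ≈⟨ *-congʳ (aᵈ≈1 a a≉0) ⟨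
      a ^ᴿ d * a ^ᴿ suc r     ≈⟨ ^-homo-* a d (suc r) ⟨
      a ^ᴿ (d ℕ.+ suc r)      ≈⟨ ^-congʳ a d+r≡Q-1 ⟩
      a ^ᴿ suc Q₂             ≈⟨ unit^[Q-1]≈1 a a≉0 ⟩
      1#                      ∎
    2+r≤q′ : suc (suc r) ≤ q′
    2+r≤q′ = ℕ.+-cancelˡ-≤ X _ _ (≡.subst₂ _≤_ (≡.sym (ℕ.+-suc X (suc r))) (ℕ.+-comm q′ X)
               (≡.subst (suc X ℕ.+ suc r ≤_) (≡.trans d+r≡Q-1 (ℕ.suc-injective Q≡q+X)) (ℕ.+-monoˡ-≤ (suc r) X<d)))

  module _ {n} (f : Polynomial n) (invariant : IsInvariantMod Q f) (e : Exponent n) (e∉ : NotInFrobPower Q e) (occurs : OccursIn e f) where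

    units-fix-exponent : ∀ i a → ¬ (a ≈ 0#) → a ^ᴿ lookup e i ≈ 1#
    units-fix-exponent i a a≉0 = *-cancelˡ occurs (begin
      coeff f e * a ^ᴿ lookup e i     ≈⟨ *-comm _ _ ⟩
      a ^ᴿ lookup e i * coeff f e     ≈⟨ coeff-act-scaling i a f e ⟨
      coeff (act (scaling i a) f) e   ≈⟨ invariant (scaling i a) (scaling-invertible i (inverse-*ʳ a a≉0)) e e∉ ⟩
      coeff f e                       ≈⟨ *-identityʳ _ ⟨
      coeff f e * 1#                  ∎)

    large-exponent-is-maximal : ∀ i → X < lookup e i → lookup e i ≡ suc Q₂
    large-exponent-is-maximal i X<eᵢ = unit-exponent-above-X≡Q-1 (lookup e i) (e∉ i) X<eᵢ (units-fix-exponent i)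

    private
      module _ {i j : Fin n} (i≢j : i ≢ j) (eᵢ≡Q-1 : lookup e i ≡ suc Q₂) (eⱼ<Q-1 : lookup e j < suc Q₂) where

        j≢i : j ≢ i
        j≢i = i≢j ∘ ≡.sym

        lookup-cong : ∀ {u v : Exponent n} l → u ≡ v → lookup u l ≡ lookup v l
        lookup-cong l = ≡.cong (λ w → lookup w l)

        ≡-from-coordinates : ∀ (u v : Exponent n) → lookup u i ≡ lookup v i → lookup u j ≡ lookup v j →
                             (∀ l → l ≢ i → l ≢ j → lookup u l ≡ lookup v l) → u ≡ v
        ≡-from-coordinates u v uᵢ≡vᵢ uⱼ≡vⱼ uₗ≡vₗ = ≗-lookup⇒≡ u v λ l → by-cases l (l Fin.≟ i) (l Fin.≟ j)
          where
          by-cases : ∀ l → Dec (l ≡ i) → Dec (l ≡ j) → lookup u l ≡ lookup v l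
          by-cases l (yes ≡.refl) _ = uᵢ≡vᵢ
          by-cases l (no _) (yes ≡.refl) = uⱼ≡vⱼ
          by-cases l (no l≢i) (no l≢j) = uₗ≡vₗ l l≢i l≢j

        -- x^t = x^e · x_j / x_i
        t : Exponent n
        t = e [ i ]≔ Q₂ [ j ]≔ suc (lookup e j)

        tᵢ : lookup t i ≡ Q₂
        tᵢ = ≡.trans (Vecₚ.lookup∘updateAt′ i j i≢j (e [ i ]≔ Q₂)) (Vecₚ.lookup∘updateAt i e)

        tⱼ : lookup t j ≡ suc (lookup e j)
        tⱼ = Vecₚ.lookup∘updateAt j (e [ i ]≔ Q₂)

        tₗ : ∀ l → l ≢ i → l ≢ j → lookup t l ≡ lookup e l
        tₗ l l≢i l≢j = ≡.trans (Vecₚ.lookup∘updateAt′ l j l≢j (e [ i ]≔ Q₂)) (Vecₚ.lookup∘updateAt′ l i l≢i e)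

        t∉ : NotInFrobPower Q t
        t∉ l with l Fin.≟ i | l Fin.≟ j
        ... | yes ≡.refl | _ = ≡.subst (_< Q) (≡.sym tᵢ) (ℕ.m<n⇒m<1+n (ℕ.n<1+n Q₂))
        ... | no _ | yes ≡.refl = ≡.subst (_< Q) (≡.sym tⱼ) (s≤s eⱼ<Q-1)
        ... | no l≢i | no l≢j = ≡.subst (_< Q) (≡.sym (tₗ l l≢i l≢j)) (e∉ l)

        t≢e : t ≢ e
        t≢e t≡e = ℕ.<-irrefl (≡.trans (≡.sym tᵢ) (≡.trans (lookup-cong i t≡e) eᵢ≡Q-1)) (ℕ.n<1+n Q₂)

        term : Exponent n → ℕ → ℕ → Exponent n
        term d a b = single i a ⊕ single j b ⊕ (d [ i ]≔ 0)

        lookup-term : ∀ d a b l → lookup (term d a b) l ≡ lookup (single i a) l ℕ.+ lookup (single j b) l ℕ.+ lookup (d [ i ]≔ 0) l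
        lookup-term d a b l = ≡.trans (lookup-⊕ (single i a ⊕ single j b) (d [ i ]≔ 0) l)
                                      (≡.cong (ℕ._+ lookup (d [ i ]≔ 0) l) (lookup-⊕ (single i a) (single j b) l))

        termᵢ : ∀ d a b → lookup (term d a b) i ≡ a
        termᵢ d a b = ≡.trans (lookup-term d a b i)
          (≡.trans (≡.cong₂ ℕ._+_ (≡.cong₂ ℕ._+_ (lookup-single-same i a) (lookup-single-other b j≢i)) (Vecₚ.lookup∘updateAt i d))
                   (≡.trans (ℕ.+-identityʳ _) (ℕ.+-identityʳ a)))

        termⱼ : ∀ d a b → lookup (term d a b) j ≡ b ℕ.+ lookup d j
        termⱼ d a b = ≡.trans (lookup-term d a b j)
          (≡.cong₂ ℕ._+_ (≡.cong₂ ℕ._+_ (lookup-single-other a i≢j) (lookup-single-same j b)) (Vecₚ.lookup∘updateAt′ j i j≢i d))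

        termₗ : ∀ d a b l → l ≢ i → l ≢ j → lookup (term d a b) l ≡ lookup d l
        termₗ d a b l l≢i l≢j = ≡.trans (lookup-term d a b l)
          (≡.cong₂ ℕ._+_ (≡.cong₂ ℕ._+_ (lookup-single-other a (l≢i ∘ ≡.sym)) (lookup-single-other b (l≢j ∘ ≡.sym)))
                         (Vecₚ.lookup∘updateAt′ l i l≢i d))

        term≡t⇒a≡Q₂ : ∀ d a b → term d a b ≡ t → a ≡ Q₂
        term≡t⇒a≡Q₂ d a b term≡t = ≡.trans (≡.sym (termᵢ d a b)) (≡.trans (lookup-cong i term≡t) tᵢ)

        -- the coefficient of x^t in the image of x^d under x_i ↦ x_i + x_j
        ψ : Exponent n → Carrier
        ψ d = binomialSum (lookup d i) (λ a b → δ t (term d a b))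

        ψ-concentrated : ∀ d b₀ → Q₂ ℕ.+ b₀ ≡ lookup d i → ψ d ≈ δ t (term d Q₂ b₀) * (lookup d i C b₀) × 1#
        ψ-concentrated d b₀ dᵢ≡ = binomialSum-concentrated (lookup d i) _ Q₂ b₀ dᵢ≡
          (λ a b _ a≢Q₂ → δ-≢ (a≢Q₂ ∘ term≡t⇒a≡Q₂ d a b))

        ψ-t : ψ t ≈ 1#
        ψ-t = begin
          ψ t                                       ≈⟨ ψ-concentrated t 0 (≡.trans (ℕ.+-identityʳ Q₂) (≡.sym tᵢ)) ⟩
          δ t (term t Q₂ 0) * (lookup t i C 0) × 1#    ≈⟨ *-cong (reflexive (≡.cong (δ t) term≡t)) (+-identityʳ 1#) ⟩
          δ t t * 1#                                ≈⟨ trans (*-identityʳ _) (δ-refl t) ⟩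
          1#                                        ∎
          where
          term≡t : term t Q₂ 0 ≡ t
          term≡t = ≡-from-coordinates _ _ (≡.trans (termᵢ t Q₂ 0) (≡.sym tᵢ)) (termⱼ t Q₂ 0) (termₗ t Q₂ 0)

        ψ-e : ψ e ≈ suc Q₂ × 1#
        ψ-e = begin
          ψ e                                        ≈⟨ ψ-concentrated e 1 (≡.trans (ℕ.+-comm Q₂ 1) (≡.sym eᵢ≡Q-1)) ⟩
          δ t (term e Q₂ 1) * (lookup e i C 1) × 1#     ≈⟨ *-cong (reflexive (≡.cong (δ t) term≡t)) (reflexive (≡.cong (_× 1#) (≡.trans (nC1≡n _) eᵢ≡Q-1))) ⟩
          δ t t * suc Q₂ × 1#                        ≈⟨ trans (*-congʳ (δ-refl t)) (*-identityˡ _) ⟩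
          suc Q₂ × 1#                                ∎
          where
          term≡t : term e Q₂ 1 ≡ t
          term≡t = ≡-from-coordinates _ _ (≡.trans (termᵢ e Q₂ 1) (≡.sym tᵢ)) (≡.trans (termⱼ e Q₂ 1) (≡.sym tⱼ))
                  (λ l l≢i l≢j → ≡.trans (termₗ e Q₂ 1 l l≢i l≢j) (≡.sym (tₗ l l≢i l≢j)))

        ψ-elsewhere : ∀ d → d ≢ t → d ≢ e → ψ d ≈ 0#
        ψ-elsewhere d d≢t d≢e with Q₂ ℕ.≤? lookup d i
        ... | no Q₂≰dᵢ = trans (binomialSum-cong (lookup d i) (λ a b a+b≡dᵢ → δ-≢ (λ term≡t →
                                 Q₂≰dᵢ (≡.subst (ℕ._≤ lookup d i) (term≡t⇒a≡Q₂ d a b term≡t) (≡.subst (a ℕ.≤_) a+b≡dᵢ (ℕ.m≤m+n a b))))))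
                               (binomialSum-zero (lookup d i))
        ... | yes Q₂≤dᵢ = trans (ψ-concentrated d b₀ Q₂+b₀≡dᵢ) (vanishes (Vecₚ.≡-dec ℕ._≟_ (term d Q₂ b₀) t))
          where
          b₀ = lookup d i ∸ Q₂
          Q₂+b₀≡dᵢ : Q₂ ℕ.+ b₀ ≡ lookup d i
          Q₂+b₀≡dᵢ = ℕ.m+[n∸m]≡n Q₂≤dᵢ
          vanishes : Dec (term d Q₂ b₀ ≡ t) → δ t (term d Q₂ b₀) * (lookup d i C b₀) × 1# ≈ 0#
          vanishes (no V≢t) = trans (*-congʳ (δ-≢ V≢t)) (zeroˡ _)
          vanishes (yes term≡t) = trans (*-congˡ (binomial-vanishes b₀ Q₂+b₀≡dᵢ b₀+dⱼ≡)) (zeroʳ _)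
            where
            b₀+dⱼ≡ : b₀ ℕ.+ lookup d j ≡ suc (lookup e j)
            b₀+dⱼ≡ = ≡.trans (≡.sym (termⱼ d Q₂ b₀)) (≡.trans (lookup-cong j term≡t) tⱼ)
            dₗ≡eₗ : ∀ l → l ≢ i → l ≢ j → lookup d l ≡ lookup e l
            dₗ≡eₗ l l≢i l≢j = ≡.trans (≡.sym (termₗ d Q₂ b₀ l l≢i l≢j)) (≡.trans (lookup-cong l term≡t) (tₗ l l≢i l≢j))
            binomial-vanishes : ∀ b → Q₂ ℕ.+ b ≡ lookup d i → b ℕ.+ lookup d j ≡ suc (lookup e j) → (lookup d i C b) × 1# ≈ 0#
            binomial-vanishes zero Q₂+0≡dᵢ dⱼ≡ = ⊥-elim (d≢t (≡-from-coordinates d t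
              (≡.trans (≡.sym Q₂+0≡dᵢ) (≡.trans (ℕ.+-identityʳ Q₂) (≡.sym tᵢ))) (≡.trans dⱼ≡ (≡.sym tⱼ))
              (λ l l≢i l≢j → ≡.trans (dₗ≡eₗ l l≢i l≢j) (≡.sym (tₗ l l≢i l≢j)))))
            binomial-vanishes (suc zero) Q₂+1≡dᵢ 1+dⱼ≡ = ⊥-elim (d≢e (≡-from-coordinates d e
              (≡.trans (≡.sym Q₂+1≡dᵢ) (≡.trans (ℕ.+-comm Q₂ 1) (≡.sym eᵢ≡Q-1))) (ℕ.suc-injective 1+dⱼ≡) dₗ≡eₗ))
            binomial-vanishes b@(suc (suc _)) Q₂+b≡dᵢ b+dⱼ≡ = trans (reflexive (≡.cong (λ N → (N C b) × 1#) (≡.sym Q₂+b≡dᵢ)))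
              ([Q-2+b]Cb×1≈0 {k ℕ.* m} Q≡pᴬ b (s≤s (s≤s z≤n)) (s≤s (ℕ.≤-trans (≡.subst (b ℕ.≤_) b+dⱼ≡ (ℕ.m≤m+n b (lookup d j))) eⱼ<Q-1)))

        ψ≈δ-combination : ∀ d → ψ d ≈ δ t d + suc Q₂ × 1# * δ e d
        ψ≈δ-combination d = by-cases (Vecₚ.≡-dec ℕ._≟_ d t) (Vecₚ.≡-dec ℕ._≟_ d e)
          where
          by-cases : Dec (d ≡ t) → Dec (d ≡ e) → ψ d ≈ δ t d + suc Q₂ × 1# * δ e d
          by-cases (yes ≡.refl) _ = trans ψ-t (sym (trans (+-cong (δ-refl t) (trans (*-congˡ (δ-≢ t≢e)) (zeroʳ _))) (+-identityʳ 1#)))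
          by-cases (no d≢t) (yes ≡.refl) = trans ψ-e (sym (trans (+-cong (δ-≢ d≢t) (trans (*-congˡ (δ-refl e)) (*-identityʳ _))) (+-identityˡ _)))
          by-cases (no d≢t) (no d≢e) = trans (ψ-elsewhere d d≢t d≢e)
            (sym (trans (+-cong (δ-≢ d≢t) (trans (*-congˡ (δ-≢ d≢e)) (zeroʳ _))) (+-identityʳ 0#)))

        coeff-transvected : coeff (act (transvection i j 1#) f) t ≈ coeff f t + suc Q₂ × 1# * coeff f e
        coeff-transvected = begin
          coeff (act (transvection i j 1#) f) t                       ≈⟨ coeff-act-transvection i j f t ⟩
          pairing f ψ                                                  ≈⟨ pairing-congʳ f ψ≈δ-combination ⟩
          pairing f (λ d → δ t d + suc Q₂ × 1# * δ e d)                ≈⟨ pairing-+ f (δ t) _ ⟩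
          pairing f (δ t) + pairing f (λ d → suc Q₂ × 1# * δ e d)      ≈⟨ +-cong (coeff≈pairing-δ f t) (trans (*-congˡ (coeff≈pairing-δ f e)) (sym (pairing-*ʳ f _ (δ e)))) ⟨
          coeff f t + suc Q₂ × 1# * coeff f e                          ∎

        maximal-beside-smaller-impossible : ⊥
        maximal-beside-smaller-impossible = occurs (x≉0∧xy≈0⇒y≈0 [Q-1]×1≉0
          (identityʳ-unique (coeff f t) _ (trans (sym coeff-transvected) (invariant (transvection i j 1#) (transvection-invertible i≢j) t t∉))))
          where
          open import Algebra.Properties.Group +-group using (identityʳ-unique)
          [Q-1]×1≉0 : ¬ (suc Q₂ × 1# ≈ 0#)
          [Q-1]×1≉0 = -1≉0 ∘ trans (sym ([Q-1]×1≈-1 {k ℕ.* m} Q≡pᴬ))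

    maximal-exponent-spreads : ∀ i → lookup e i ≡ suc Q₂ → ∀ j → lookup e j ≡ suc Q₂
    maximal-exponent-spreads i eᵢ≡Q-1 j with lookup e j ℕ.≟ suc Q₂
    ... | yes eⱼ≡Q-1 = eⱼ≡Q-1
    ... | no eⱼ≢Q-1 = ⊥-elim (maximal-beside-smaller-impossible i≢j eᵢ≡Q-1 (ℕ.≤∧≢⇒< (ℕ.≤-pred (e∉ j)) eⱼ≢Q-1))
      where
      i≢j : i ≢ j
      i≢j ≡.refl = eⱼ≢Q-1 eᵢ≡Q-1

    invariant-exponents : (e ≡ replicate n (suc Q₂)) ⊎ (∀ i → lookup e i ≤ X)
    invariant-exponents with Finₚ.all? (λ i → lookup e i ℕ.≤? X)
    ... | yes all≤X = inj₂ all≤X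
    ... | no ¬all≤X with Finₚ.¬∀⟶∃¬ n _ (λ i → lookup e i ℕ.≤? X) ¬all≤X
    ...   | i , eᵢ≰X = inj₁ (≗-lookup⇒≡ _ _ λ j →
            ≡.trans (maximal-exponent-spreads i (large-exponent-is-maximal i (ℕ.≰⇒> eᵢ≰X)) j) (≡.sym (Vecₚ.lookup-replicate j (suc Q₂))))

prime-power-≥2 : ∀ {q} → IsPrimePower q → 2 ≤ q
prime-power-≥2 (p , suc k , p-prime , _ , ≡.refl) =
  ℕ.*-mono-≤ (ℕ.nonTrivial⇒n>1 p {{prime⇒nonTrivial p-prime}}) (ℕ.m^n>0 p {{prime⇒nonZero p-prime}} k)

n≤n^m : ∀ n m → 1 ≤ n → 1 ≤ m → n ≤ n ^ m
n≤n^m n (suc m) 1≤n _ = ℕ.m≤m*n n (n ^ m) {{ℕ.m^n≢0 n m {{ℕ.>-nonZero 1≤n}}}}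

proposition10p1 : ∀ {c ℓ} (q n m : ℕ) → IsPrimePower q → 1 ≤ n → 1 ≤ m →
    (F : CommutativeRing c ℓ) → IsField F → HasCardinality F q →
    let open Poly F in
    (f : Polynomial n) → IsInvariantMod (q ^ m) f →
    (e : Exponent n) → NotInFrobPower (q ^ m) e → OccursIn e f →
    (e ≡ replicate n (q ^ m ∸ 1)) ⊎ (∀ i → lookup e i ≤ q ^ m ∸ q)
proposition10p1 q n m q-prime-power _ 1≤m F isField card f invariant e e∉ occurs
  with q | q-prime-power | prime-power-≥2 q-prime-power
... | suc q′ | (p , k , p-prime , _ , q≡pᵏ) | 2≤q
  with suc q′ ^ m in qᵐ≡Q | n≤n^m (suc q′) m (s≤s z≤n) 1≤m
... | suc (suc Q₂) | q≤Q = invariant-exponents f invariant e e∉ occurs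
  where open InvariantMonomials F isField q′ card {p} {k} p-prime q≡pᵏ m (≡.sym qᵐ≡Q) (≡.sym (ℕ.m+[n∸m]≡n q≤Q))
... | suc zero | s≤s z≤n = ⊥-elim (ℕ.<-irrefl ≡.refl 2≤q)
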